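{- Let $\mathbf{h}=h^m\cdots h^1\in\mathcal{H}^{m,\star}$ be a lowest weight element of the $\star$-crystal, of weight $\lambda=(\lambda_1,\dots,\lambda_m)$. Then there exists $r\geqslant1$ such that $\lambda_i=0$ for $i<r$ and $\lambda_{i+1}\geqslant\lambda_i$ for $1\leqslant i<m$. Moreover, writing $h^j=h^j_{\lambda_j}\cdots h^j_2h^j_1$ (so $h^j_1<h^j_2<\cdots<h^j_{\lambda_j}$) for $r\leqslant j\leqslant m$, the $\star$-insertion tableau $P^\star(\mathbf{h})$ has, for each $i$, its $i$-th row (counted from the bottom) equal to $h^{m+1-i}_1,h^{m+1-i}_2,\dots,h^{m+1-i}_{\lambda_{m+1-i}}$ (from left to right); that is, $P^\star(\mathbf{h})$ has rows, from bottom to top, given by the factors $h^m,h^{m-1},\dots,h^r$ written in increasing order.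
   Context: The 0-Hecke monoid: words in positive integers modulo the equivalence generated by $pq=qp$ ($|p-q|>1$), $pqp=qpq$, $pp=p$ on consecutive subwords; a word is fully-commutative if no minimal-length word equivalent to it contains a consecutive subword $i(i+1)i$ or $i(i-1)i$. $\mathcal{H}^{m,\star}$ is the set of decreasing factorizations $\mathbf{h}=h^m\cdots h^1$ (each $h^i$ a possibly empty strictly decreasing word) whose concatenation is fully-commutative. Weight: $\operatorname{wt}(\mathbf{h})=(\mathsf{len}(h^1),\dots,\mathsf{len}(h^m))$. $\star$-crystal operators $f^\star_i$ ($1\leqslant i<m$): pair letters $b$ of $h^{i+1}$, in decreasing order, each with the smallest not-yet-paired letter $a\geqslant b$ of $h^i$ if one exists. If all letters of $h^i$ are paired, $f^\star_i(\mathbf{h})=0$; else with $x$ the largest unpaired letter of $h^i$: if $x+1\in h^i\cap h^{i+1}$, remove $x+1$ from $h^i$ and add $x$ to $h^{i+1}$; otherwise move $x$ from $h^i$ to $h^{i+1}$. $\mathbf{h}$ is lowest weight if $f^\star_i(\mathbf{h})=0$ for all $1\leqslant i<m$. $\star$-insertion tableau $P^\star(\mathbf{h})$: write $h^m\cdots h^1=a_1\cdots a_N$; starting from the empty tableau (French notation, rows from the bottom) insert $a_N$, then $a_{N-1}$, ..., then $a_1$, where inserting $x$ starts at the bottom row and inserting $x$ into a row $R$: Case 1: if $R$ empty or $x>\max(R)$, append $x$, stop; Case 2: otherwise if $x\notin R$, replace the smallest $y\in R$ with $y>x$ by $x$, insert $y$ into the next row up; Case 3: if $x\in R$, leave $R$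 unchanged, insert into the next row up the smallest $y\in R$ with $[y,x]\subseteq R$. -}

module Defs where

open import Data.Nat.Base
open import Data.Bool.Base using (Bool; true; false; if_then_else_; _∧_; _∨_; not)
open import Data.List.Base using (List; []; _∷_; _++_; [_]; length; concat; reverse; map; foldr; upTo)
open import Data.Maybe.Base using (Maybe; just; nothing)
open import Data.Product.Base using (Σ; ∃; _×_; _,_)
open import Data.Sum.Base using (_⊎_)
open import Data.Vec.Base using (Vec; toList) renaming ([] to []v; _∷_ to _∷v_)
open import Relation.Binary.PropositionalEquality using (_≡_)
open import Relation.Binary.Construct.Closure.ReflexiveTransitive using (Star)
open import Data.List.Relation.Unary.All using (All)
open import Data.List.Relation.Unary.Linked using (Linked)
open import Relation.Nullary using (¬_)

-- Words in (positive) integers; letters are natural numbers, positivity is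
-- imposed separately in the membership predicate of H^{m,⋆}.
Word : Set
Word = List ℕ

data Step : Word → Word → Set where
  comm  : ∀ u v p q → (suc p < q ⊎ suc q < p) →
          Step (u ++ p ∷ q ∷ v) (u ++ q ∷ p ∷ v)
  braid : ∀ u v p q → Step (u ++ p ∷ q ∷ p ∷ v) (u ++ q ∷ p ∷ q ∷ v)
  idem  : ∀ u v p → Step (u ++ p ∷ p ∷ v) (u ++ p ∷ v)

SymStep : Word → Word → Set
SymStep u v = Step u v ⊎ Step v u

HeckeEq : Word → Word → Set
HeckeEq = Star SymStep

MinimalIn : Word → Word → Set
MinimalIn w v = HeckeEq w v × (∀ u → HeckeEq w u → length v ≤ length u)

ContainsBraidPattern : Word → Set
ContainsBraidPattern v =
  ∃ λ a → ∃ λ b → ∃ λ i →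
    (v ≡ a ++ i ∷ suc i ∷ i ∷ b) ⊎ (v ≡ a ++ suc i ∷ i ∷ suc i ∷ b)

FullyCommutative : Word → Set
FullyCommutative w = ∀ v → MinimalIn w v → ¬ ContainsBraidPattern v

-- Decreasing factorizations h = h^m ⋯ h^1, stored as a vector whose
-- position 0 holds h^1, position 1 holds h^2, ...

Fact : ℕ → Set
Fact m = Vec Word m

-- fac h j = h^j (1-based); [] outside 1..m
fac : ∀ {m} → Fact m → ℕ → Word
fac []v        _             = []
fac (x ∷v xs)  zero          = []
fac (x ∷v xs)  (suc zero)    = x
fac (x ∷v xs)  (suc (suc k)) = fac xs (suc k)

setFac : ∀ {m} → ℕ → Word → Fact m → Fact m
setFac _             w []v       = []v
setFac zero          w (x ∷v xs) = x ∷v xs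
setFac (suc zero)    w (x ∷v xs) = w ∷v xs
setFac (suc (suc k)) w (x ∷v xs) = x ∷v setFac (suc k) w xs

wt : ∀ {m} → Fact m → ℕ → ℕ
wt h i = length (fac h i)

word : ∀ {m} → Fact m → Word
word h = concat (reverse (toList h))

InH : (m : ℕ) → Fact m → Set
InH m h = All (Linked _>_) (toList h)
        × All (All (λ a → 1 ≤ a)) (toList h)
        × FullyCommutative (word h)

elem : ℕ → Word → Bool
elem x []       = false
elem x (y ∷ ys) = (x ≡ᵇ y) ∨ elem x ys

bfilter : (ℕ → Bool) → Word → Word
bfilter p []       = []
bfilter p (y ∷ ys) = if p y then y ∷ bfilter p ys else bfilter p ys

allB : (ℕ → Bool) → Word → Bool
allB p []       = true
allB p (y ∷ ys) = p y ∧ allB p ys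

minimumM : Word → Maybe ℕ
minimumM []       = nothing
minimumM (y ∷ ys) with minimumM ys
... | nothing = just y
... | just z  = just (y ⊓ z)

maximumM : Word → Maybe ℕ
maximumM []       = nothing
maximumM (y ∷ ys) with maximumM ys
... | nothing = just y
... | just z  = just (y ⊔ z)

removeOne : ℕ → Word → Word
removeOne x []       = []
removeOne x (y ∷ ys) = if x ≡ᵇ y then ys else y ∷ removeOne x ys

replaceOne : ℕ → ℕ → Word → Word
replaceOne y x []       = []
replaceOne y x (z ∷ zs) = if y ≡ᵇ z then x ∷ zs else z ∷ replaceOne y x zs

insertDec : ℕ → Word → Word
insertDec x []       = x ∷ []
insertDec x (y ∷ ys) = if y <ᵇ x then x ∷ y ∷ ys else y ∷ insertDec x ys

pairOne : ℕ → Word → Word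
pairOne b A with minimumM (bfilter (b ≤ᵇ_) A)
... | nothing = A
... | just a  = removeOne a A

-- unpaired B A: the letters of A left unpaired after pairing the letters of
-- B, taken in the order of B (decreasing, as B is a decreasing factor)
unpaired : Word → Word → Word
unpaired []      A = A
unpaired (b ∷ B) A = unpaired B (pairOne b A)

-- f⋆_i ; nothing represents 0
fStar : ∀ {m} → ℕ → Fact m → Maybe (Fact m)
fStar {m} i h with maximumM (unpaired (fac h (suc i)) (fac h i))
... | nothing = nothing
... | just x  =
  if elem (suc x) (fac h i) ∧ elem (suc x) (fac h (suc i))
  then just (setFac i (removeOne (suc x) (fac h i))
              (setFac (suc i) (insertDec x (fac h (suc i))) h))
  else just (setFac i (removeOne x (fac h i))
              (setFac (suc i) (insertDec x (fac h (suc i))) h))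

LowestWeight : (m : ℕ) → Fact m → Set
LowestWeight m h = ∀ i → 1 ≤ i → i < m → fStar i h ≡ nothing

-- Tableau in French notation: list of rows, bottom row first,
-- each row read left to right.
Tableau : Set
Tableau = List Word

downRun : ℕ → Word → ℕ
downRun zero    R = zero
downRun (suc k) R = if elem k R then downRun k R else suc k

data Bump : Set where
  stop : Word → Bump
  bump : Word → ℕ → Bump

insertRow : ℕ → Word → Bump
insertRow x R =
  if allB (λ y → y <ᵇ x) R then stop (R ++ [ x ])
  else if elem x R then bump R (downRun x R)
  else caseTwo (minimumM (bfilter (x <ᵇ_) R))
  where
  caseTwo : Maybe ℕ → Bump
  caseTwo nothing  = stop (R ++ [ x ])   -- unreachable
  caseTwo (just y) = bump (replaceOne y x R) y

insertTab : ℕ → Tableau → Tableau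
insertTab x []      = [ x ∷ [] ]
insertTab x (R ∷ T) with insertRow x R
... | stop R'   = R' ∷ T
... | bump R' y = R' ∷ insertTab y T

-- P⋆(h): for h^m ⋯ h^1 = a_1 ⋯ a_N, insert a_N, then a_{N-1}, ..., then a_1
Pstar : ∀ {m} → Fact m → Tableau
Pstar h = foldr insertTab [] (word h)

rowsFrom : ∀ {m} → Fact m → ℕ → Tableau
rowsFrom {m} h r = map (λ k → reverse (fac h (m ∸ k))) (upTo (suc m ∸ r))

-- Lowest weight means that every f⋆ᵢ vanishes, i.e. every letter of hⁱ is paired with a letter
-- of hⁱ⁺¹. Hence λᵢ ≤ λᵢ₊₁, and for every t at most as many letters of hⁱ as of hⁱ⁺¹ are ≤ t.
-- The ⋆-insertion reads h¹, h², … in turn, each factor in increasing order, and the Hall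
-- inequality makes hⁱ⁺¹ bump the row hⁱ out whole, letter by letter. This could only fail in
-- Case 3 at a letter c of both factors with c - 1 already inserted; walking down the common
-- run of the two factors then gives y with y, y + 1 in both and no letter of hⁱ⁺¹ just below y.
-- Commuting letters turns hⁱ⁺¹hⁱ into a word containing (y+1) y (y+1) or y (y+1) y. Such a
-- pattern is reduced, so it lies in a minimal word equivalent to h, against full commutativity.
-- Lengths in the 0-Hecke monoid are computed as the number of effective swaps in the Demazure
-- action of words on sequences ℕ → ℕ, which is invariant under the relations.

module Submission where

open import Defs
open import Data.Nat.Base using (ℕ; suc; _≤_; _<_)
open import Data.Product.Base using (Σ; _×_)
open import Relation.Binary.PropositionalEquality using (_≡_)

open import Data.Nat.Base
open import Data.Nat.Properties
open import Data.Bool.Base using (true; false; if_then_else_; T; _∧_)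
open import Data.Product.Base using (_,_; proj₁; proj₂; uncurry)
open import Data.Sum.Base using (_⊎_; inj₁; inj₂) renaming (swap to ⊎-swap)
open import Data.Empty using (⊥; ⊥-elim)
open import Data.Unit.Base using (⊤; tt)
open import Data.Maybe.Base using (just; nothing)
open import Data.Vec.Base using (toList) renaming ([] to []ᵥ; _∷_ to _∷ᵥ_)
open import Data.List.Base
  using ([]; _∷_; _++_; [_]; length; reverse; initLast; _∷ʳ′_; concat; foldr; map; upTo)
open import Data.List.Properties
  using (++-assoc; ++-identityʳ; reverse-++; length-++; length-reverse; reverse-involutive; ++-monoid;
         unfold-reverse; concat-++; foldr-++; map-++; map-cong-local; applyUpTo-∷ʳ)
open import Data.List.Membership.Propositional using (_∈_)
open import Data.List.Membership.Propositional.Properties using (∈-++⁺ˡ; ∈-++⁺ʳ; ∈-++⁻)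
open import Data.List.Relation.Binary.Pointwise.Base using (Pointwise; []; _∷_)
open import Data.List.Relation.Binary.Subset.Propositional using (_⊆_)
open import Data.List.Relation.Unary.All as All using (All; []; _∷_)
open import Data.List.Relation.Unary.All.Properties using (++⁺; ++⁻ˡ; all-upTo)
open import Data.List.Relation.Unary.AllPairs as AllPairs using (AllPairs; []; _∷_)
open import Data.List.Relation.Unary.AllPairs.Properties using () renaming (++⁺ to AllPairs-++⁺)
open import Data.List.Relation.Unary.Any using (here; there; tail)
import Data.List.Relation.Unary.Any.Properties as Any
open import Data.List.Relation.Unary.Linked.Properties using (Linked⇒AllPairs)
open import Algebra.Solver.Monoid (++-monoid ℕ) using (solve; _⊜_; _⊕_)
open import Function.Base using (_∘_; id)
open import Relation.Nullary using (¬_; yes; no)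
open import Relation.Nullary.Reflects using (Reflects; ofʸ; ofⁿ; det; fromEquivalence)
open import Relation.Binary.Definitions using (tri<; tri≈; tri>)
open import Relation.Binary.PropositionalEquality
  using (_≢_; refl; sym; trans; cong; cong₂; subst; subst₂; _≗_; module ≡-Reasoning)
open import Relation.Binary.Construct.Closure.ReflexiveTransitive as Star using (ε; _◅_; _◅◅_; gmap)
open import Relation.Binary.Construct.Closure.ReflexiveTransitive.Properties using (module StarReasoning)

variable
  m n : ℕ

<ᵇ-true : m < n → (m <ᵇ n) ≡ true
<ᵇ-true m<n = det (<ᵇ-reflects-< _ _) (ofʸ m<n)

<ᵇ-false : n ≤ m → (m <ᵇ n) ≡ false
<ᵇ-false n≤m = det (<ᵇ-reflects-< _ _) (ofⁿ (≤⇒≯ n≤m))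

≤ᵇ-true : m ≤ n → (m ≤ᵇ n) ≡ true
≤ᵇ-true m≤n = det (≤ᵇ-reflects-≤ _ _) (ofʸ m≤n)

≤ᵇ-false : n < m → (m ≤ᵇ n) ≡ false
≤ᵇ-false n<m = det (≤ᵇ-reflects-≤ _ _) (ofⁿ (<⇒≱ n<m))

≡ᵇ-reflects-≡ : ∀ m n → Reflects (m ≡ n) (m ≡ᵇ n)
≡ᵇ-reflects-≡ m n = fromEquivalence (≡ᵇ⇒≡ m n) (≡⇒≡ᵇ m n)

≡ᵇ-refl : ∀ n → (n ≡ᵇ n) ≡ true
≡ᵇ-refl n = det (≡ᵇ-reflects-≡ n n) (ofʸ refl)

≡ᵇ-false : m ≢ n → (m ≡ᵇ n) ≡ false
≡ᵇ-false m≢n = det (≡ᵇ-reflects-≡ _ _) (ofⁿ m≢n)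

n≢1+n : ∀ n → n ≢ suc n
n≢1+n n ()

n≢2+n : ∀ n → n ≢ suc (suc n)
n≢2+n n ()

2+n≢n : ∀ n → suc (suc n) ≢ n
2+n≢n n ()

ltBit : ℕ → ℕ → ℕ
ltBit m n = if m <ᵇ n then 1 else 0

Triple : Set
Triple = ℕ × ℕ × ℕ

sort₀ : Triple → Triple
sort₀ (x , y , z) = if x <ᵇ y then (y , x , z) else (x , y , z)

sort₁ : Triple → Triple
sort₁ (x , y , z) = if y <ᵇ z then (x , z , y) else (x , y , z)

asc₀ : Triple → ℕ
asc₀ (x , y , z) = ltBit x y

asc₁ : Triple → ℕ
asc₁ (x , y , z) = ltBit y z

ascendingPairs : Triple → ℕ
ascendingPairs (x , y , z) = ltBit x y + ltBit x z + ltBit y z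

sort₀-⊔⊓ : ∀ x y z → sort₀ (x , y , z) ≡ (x ⊔ y , x ⊓ y , z)
sort₀-⊔⊓ x y z with x <? y
... | yes x<y rewrite <ᵇ-true x<y | m≤n⇒m⊔n≡n (<⇒≤ x<y) | m≤n⇒m⊓n≡m (<⇒≤ x<y) = refl
... | no x≮y  rewrite <ᵇ-false (≮⇒≥ x≮y) | m≥n⇒m⊔n≡m (≮⇒≥ x≮y) | m≥n⇒m⊓n≡n (≮⇒≥ x≮y)
  = refl

sort₁-⊔⊓ : ∀ x y z → sort₁ (x , y , z) ≡ (x , y ⊔ z , y ⊓ z)
sort₁-⊔⊓ x y z with y <? z
... | yes y<z rewrite <ᵇ-true y<z | m≤n⇒m⊔n≡n (<⇒≤ y<z) | m≤n⇒m⊓n≡m (<⇒≤ y<z) = refl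
... | no y≮z  rewrite <ᵇ-false (≮⇒≥ y≮z) | m≥n⇒m⊔n≡m (≮⇒≥ y≮z) | m≥n⇒m⊓n≡n (≮⇒≥ y≮z)
  = refl

⊔-braid : ∀ x y z → x ⊔ y ⊔ (x ⊓ y ⊔ z) ≡ x ⊔ (y ⊔ z)
⊔-braid x y z = begin
  x ⊔ y ⊔ (x ⊓ y ⊔ z)   ≡⟨ ⊔-assoc (x ⊔ y) (x ⊓ y) z ⟨
  x ⊔ y ⊔ x ⊓ y ⊔ z     ≡⟨ cong (_⊔ z) (m≥n⇒m⊔n≡m (m⊓n≤m⊔n x y)) ⟩
  x ⊔ y ⊔ z             ≡⟨ ⊔-assoc x y z ⟩
  x ⊔ (y ⊔ z)           ∎
  where open ≡-Reasoning

⊓-braid : ∀ x y z → x ⊓ y ⊓ z ≡ x ⊓ (y ⊔ z) ⊓ (y ⊓ z)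
⊓-braid x y z = begin
  x ⊓ y ⊓ z                 ≡⟨ ⊓-assoc x y z ⟩
  x ⊓ (y ⊓ z)               ≡⟨ cong (x ⊓_) (m≥n⇒m⊓n≡n (m⊓n≤m⊔n y z)) ⟨
  x ⊓ ((y ⊔ z) ⊓ (y ⊓ z))   ≡⟨ ⊓-assoc x (y ⊔ z) (y ⊓ z) ⟨
  x ⊓ (y ⊔ z) ⊓ (y ⊓ z)     ∎
  where open ≡-Reasoning

median-braid : ∀ x y z → (x ⊔ y) ⊓ (x ⊓ y ⊔ z) ≡ x ⊓ (y ⊔ z) ⊔ y ⊓ z
median-braid x y z = begin
  (x ⊔ y) ⊓ (x ⊓ y ⊔ z)               ≡⟨ ⊓-distribˡ-⊔ (x ⊔ y) (x ⊓ y) z ⟩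
  (x ⊔ y) ⊓ (x ⊓ y) ⊔ (x ⊔ y) ⊓ z
    ≡⟨ cong₂ _⊔_ (m≥n⇒m⊓n≡n (m⊓n≤m⊔n x y)) (⊓-distribʳ-⊔ z x y) ⟩
  x ⊓ y ⊔ (x ⊓ z ⊔ y ⊓ z)             ≡⟨ ⊔-assoc (x ⊓ y) (x ⊓ z) (y ⊓ z) ⟨
  x ⊓ y ⊔ x ⊓ z ⊔ y ⊓ z               ≡⟨ cong (_⊔ y ⊓ z) (⊓-distribˡ-⊔ x y z) ⟨
  x ⊓ (y ⊔ z) ⊔ y ⊓ z                 ∎
  where open ≡-Reasoning

-- Both sides sort the triple into (maximum, median, minimum).
sort-braid : ∀ t → sort₀ (sort₁ (sort₀ t)) ≡ sort₁ (sort₀ (sort₁ t))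
sort-braid (x , y , z) = begin
  sort₀ (sort₁ (sort₀ (x , y , z)))
    ≡⟨ cong (sort₀ ∘ sort₁) (sort₀-⊔⊓ x y z) ⟩
  sort₀ (sort₁ (x ⊔ y , x ⊓ y , z))
    ≡⟨ cong sort₀ (sort₁-⊔⊓ (x ⊔ y) (x ⊓ y) z) ⟩
  sort₀ (x ⊔ y , x ⊓ y ⊔ z , x ⊓ y ⊓ z)
    ≡⟨ sort₀-⊔⊓ (x ⊔ y) (x ⊓ y ⊔ z) (x ⊓ y ⊓ z) ⟩
  (x ⊔ y ⊔ (x ⊓ y ⊔ z) , (x ⊔ y) ⊓ (x ⊓ y ⊔ z) , x ⊓ y ⊓ z)
    ≡⟨ cong₂ _,_ (⊔-braid x y z) (cong₂ _,_ (median-braid x y z) (⊓-braid x y z)) ⟩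
  (x ⊔ (y ⊔ z) , x ⊓ (y ⊔ z) ⊔ y ⊓ z , x ⊓ (y ⊔ z) ⊓ (y ⊓ z))
    ≡⟨ sort₁-⊔⊓ (x ⊔ (y ⊔ z)) (x ⊓ (y ⊔ z)) (y ⊓ z) ⟨
  sort₁ (x ⊔ (y ⊔ z) , x ⊓ (y ⊔ z) , y ⊓ z)
    ≡⟨ cong sort₁ (sort₀-⊔⊓ x (y ⊔ z) (y ⊓ z)) ⟨
  sort₁ (sort₀ (x , y ⊔ z , y ⊓ z))
    ≡⟨ cong (sort₁ ∘ sort₀) (sort₁-⊔⊓ x y z) ⟨
  sort₁ (sort₀ (sort₁ (x , y , z)))   ∎
  where open ≡-Reasoning

asc₀+ascendingPairs : ∀ t → asc₀ t + ascendingPairs (sort₀ t) ≡ ascendingPairs t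
asc₀+ascendingPairs (x , y , z) with x <? y
... | yes x<y rewrite <ᵇ-true x<y | <ᵇ-false (<⇒≤ x<y) = cong suc (+-comm (ltBit y z) (ltBit x z))
... | no x≮y  rewrite <ᵇ-false (≮⇒≥ x≮y) | <ᵇ-false (≮⇒≥ x≮y) = refl

asc₁+ascendingPairs : ∀ t → asc₁ t + ascendingPairs (sort₁ t) ≡ ascendingPairs t
asc₁+ascendingPairs (x , y , z) with y <? z
... | yes y<z rewrite <ᵇ-true y<z | <ᵇ-false (<⇒≤ y<z) =
  trans (cong suc (trans (+-identityʳ _) (+-comm (ltBit x z) (ltBit x y)))) (+-comm 1 _)
... | no y≮z  rewrite <ᵇ-false (≮⇒≥ y≮z) | <ᵇ-false (≮⇒≥ y≮z) = refl

sort₀₁₀-ascents : ∀ t → asc₀ t + (asc₁ (sort₀ t) + asc₀ (sort₁ (sort₀ t)))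
                        + ascendingPairs (sort₀ (sort₁ (sort₀ t))) ≡ ascendingPairs t
sort₀₁₀-ascents t = begin
  a + (b + c) + ascendingPairs (sort₀ (sort₁ (sort₀ t)))   ≡⟨ +-assoc a (b + c) _ ⟩
  a + (b + c + ascendingPairs (sort₀ (sort₁ (sort₀ t))))   ≡⟨ cong (a +_) (+-assoc b c _) ⟩
  a + (b + (c + ascendingPairs (sort₀ (sort₁ (sort₀ t)))))
    ≡⟨ cong (λ k → a + (b + k)) (asc₀+ascendingPairs (sort₁ (sort₀ t))) ⟩
  a + (b + ascendingPairs (sort₁ (sort₀ t)))               ≡⟨ cong (a +_) (asc₁+ascendingPairs (sort₀ t)) ⟩
  a + ascendingPairs (sort₀ t)                             ≡⟨ asc₀+ascendingPairs t ⟩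
  ascendingPairs t                                         ∎
  where
  open ≡-Reasoning
  a = asc₀ t
  b = asc₁ (sort₀ t)
  c = asc₀ (sort₁ (sort₀ t))

sort₁₀₁-ascents : ∀ t → asc₁ t + (asc₀ (sort₁ t) + asc₁ (sort₀ (sort₁ t)))
                        + ascendingPairs (sort₁ (sort₀ (sort₁ t))) ≡ ascendingPairs t
sort₁₀₁-ascents t = begin
  a + (b + c) + ascendingPairs (sort₁ (sort₀ (sort₁ t)))   ≡⟨ +-assoc a (b + c) _ ⟩
  a + (b + c + ascendingPairs (sort₁ (sort₀ (sort₁ t))))   ≡⟨ cong (a +_) (+-assoc b c _) ⟩
  a + (b + (c + ascendingPairs (sort₁ (sort₀ (sort₁ t)))))
    ≡⟨ cong (λ k → a + (b + k)) (asc₁+ascendingPairs (sort₀ (sort₁ t))) ⟩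
  a + (b + ascendingPairs (sort₀ (sort₁ t)))               ≡⟨ cong (a +_) (asc₀+ascendingPairs (sort₁ t)) ⟩
  a + ascendingPairs (sort₁ t)                             ≡⟨ asc₁+ascendingPairs t ⟩
  ascendingPairs t                                         ∎
  where
  open ≡-Reasoning
  a = asc₁ t
  b = asc₀ (sort₁ t)
  c = asc₁ (sort₀ (sort₁ t))

-- Each effective swap removes exactly one ascending pair, and both sides end at the same triple.
ascents-braid : ∀ t → asc₀ t + (asc₁ (sort₀ t) + asc₀ (sort₁ (sort₀ t)))
                    ≡ asc₁ t + (asc₀ (sort₁ t) + asc₁ (sort₀ (sort₁ t)))
ascents-braid t = +-cancelʳ-≡ (ascendingPairs (sort₀ (sort₁ (sort₀ t)))) _ _
  (trans (sort₀₁₀-ascents t)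
    (sym (trans (cong (λ s → asc₁ t + (asc₀ (sort₁ t) + asc₁ (sort₀ (sort₁ t))) + ascendingPairs s)
                      (sort-braid t))
                (sort₁₀₁-ascents t))))

-- The Demazure action of words on sequences

Perm : Set
Perm = ℕ → ℕ

swap : ℕ → ℕ → ℕ
swap b n = if n ≡ᵇ b then suc b else if n ≡ᵇ suc b then b else n

act : Perm → ℕ → Perm
act π b n = if π b <ᵇ π (suc b) then π (swap b n) else π n

ascent : Perm → ℕ → ℕ
ascent π b = ltBit (π b) (π (suc b))

actWord : Perm → Word → Perm
actWord π []      = π
actWord π (b ∷ w) = actWord (act π b) w

ascents : Perm → Word → ℕ
ascents π []      = 0
ascents π (b ∷ w) = ascent π b + ascents (act π b) w

demazure : Word → Perm
demazure = actWord id

heckeLength : Word → ℕ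
heckeLength = ascents id

swap-here : ∀ b → swap b b ≡ suc b
swap-here b rewrite ≡ᵇ-refl b = refl

swap-next : ∀ b → swap b (suc b) ≡ b
swap-next b rewrite ≡ᵇ-false (1+n≢n {b}) | ≡ᵇ-refl b = refl

swap-away : ∀ b n → n ≢ b → n ≢ suc b → swap b n ≡ n
swap-away b n n≢b n≢b+1 rewrite ≡ᵇ-false n≢b | ≡ᵇ-false n≢b+1 = refl

act-ascent : ∀ π b → (π b <ᵇ π (suc b)) ≡ true → act π b ≗ π ∘ swap b
act-ascent π b e n rewrite e = refl

act-nonascent : ∀ π b → (π b <ᵇ π (suc b)) ≡ false → act π b ≗ π
act-nonascent π b e n rewrite e = refl

ascent-true : ∀ π b → (π b <ᵇ π (suc b)) ≡ true → ascent π b ≡ 1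
ascent-true π b e rewrite e = refl

ascent-false : ∀ π b → (π b <ᵇ π (suc b)) ≡ false → ascent π b ≡ 0
ascent-false π b e rewrite e = refl

ascent≤1 : ∀ π b → ascent π b ≤ 1
ascent≤1 π b with π b <ᵇ π (suc b)
... | true  = ≤-refl
... | false = z≤n

act-cong : ∀ {π σ} b → π ≗ σ → act π b ≗ act σ b
act-cong {π} {σ} b π≗σ n rewrite π≗σ b | π≗σ (suc b) | π≗σ n | π≗σ (swap b n) = refl

ascent-cong : ∀ {π σ} b → π ≗ σ → ascent π b ≡ ascent σ b
ascent-cong b π≗σ = cong₂ ltBit (π≗σ b) (π≗σ (suc b))

actWord-cong : ∀ {π σ} w → π ≗ σ → actWord π w ≗ actWord σ w
actWord-cong []      π≗σ = π≗σ
actWord-cong (b ∷ w) π≗σ = actWord-cong w (act-cong b π≗σ)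

ascents-cong : ∀ {π σ} w → π ≗ σ → ascents π w ≡ ascents σ w
ascents-cong []      π≗σ = refl
ascents-cong (b ∷ w) π≗σ = cong₂ _+_ (ascent-cong b π≗σ) (ascents-cong w (act-cong b π≗σ))

actWord-++ : ∀ π u v → actWord π (u ++ v) ≡ actWord (actWord π u) v
actWord-++ π []      v = refl
actWord-++ π (b ∷ u) v = actWord-++ (act π b) u v

ascents-++ : ∀ π u v → ascents π (u ++ v) ≡ ascents π u + ascents (actWord π u) v
ascents-++ π []      v = refl
ascents-++ π (b ∷ u) v rewrite ascents-++ (act π b) u v = sym (+-assoc (ascent π b) _ _)

ascents≤length : ∀ π w → ascents π w ≤ length w
ascents≤length π []      = z≤n
ascents≤length π (b ∷ w) = +-mono-≤ (ascent≤1 π b) (ascents≤length (act π b) w)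

demazure-∷ʳ : ∀ w b → demazure (w ++ [ b ]) ≗ act (demazure w) b
demazure-∷ʳ w b n = cong (λ π → π n) (actWord-++ id w [ b ])

record ActsAlike (s t : Word) : Set where
  field
    alike : ∀ π → actWord π s ≗ actWord π t × ascents π s ≡ ascents π t
open ActsAlike

actsAlike-refl : ∀ {s} → ActsAlike s s
actsAlike-refl .alike π = (λ _ → refl) , refl

actsAlike-sym : ∀ {s t} → ActsAlike s t → ActsAlike t s
actsAlike-sym s~t .alike π = (λ n → sym (proj₁ (s~t .alike π) n)) , sym (proj₂ (s~t .alike π))

actsAlike-trans : ∀ {s t r} → ActsAlike s t → ActsAlike t r → ActsAlike s r
actsAlike-trans s~t t~r .alike π =
  (λ n → trans (proj₁ (s~t .alike π) n) (proj₁ (t~r .alike π) n)) ,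
  trans (proj₂ (s~t .alike π)) (proj₂ (t~r .alike π))

actsAlike-inContext : ∀ {s t} → ActsAlike s t → ∀ u v → ActsAlike (u ++ s ++ v) (u ++ t ++ v)
actsAlike-inContext {s} {t} s~t u v .alike π = acts , counts
  where
  ρ = actWord π u
  acts : actWord π (u ++ s ++ v) ≗ actWord π (u ++ t ++ v)
  acts n rewrite actWord-++ π u (s ++ v) | actWord-++ π u (t ++ v)
               | actWord-++ ρ s v | actWord-++ ρ t v
               = actWord-cong v (proj₁ (s~t .alike ρ)) n
  counts : ascents π (u ++ s ++ v) ≡ ascents π (u ++ t ++ v)
  counts rewrite ascents-++ π u (s ++ v) | ascents-++ π u (t ++ v)
               | ascents-++ ρ s v | ascents-++ ρ t v
               = cong (ascents π u +_)
                   (cong₂ _+_ (proj₂ (s~t .alike ρ)) (ascents-cong v (proj₁ (s~t .alike ρ))))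

act-removesAscent : ∀ π p → (act π p p <ᵇ act π p (suc p)) ≡ false
act-removesAscent π p with π p <? π (suc p)
... | yes asc
  rewrite act-ascent π p (<ᵇ-true asc) p | act-ascent π p (<ᵇ-true asc) (suc p)
        | swap-here p | swap-next p = <ᵇ-false (<⇒≤ asc)
... | no ¬asc = trans (cong₂ _<ᵇ_ (act-nonascent π p e p) (act-nonascent π p e (suc p))) e
  where e = <ᵇ-false (≮⇒≥ ¬asc)

actsAlike-idem : ∀ p → ActsAlike (p ∷ p ∷ []) (p ∷ [])
actsAlike-idem p .alike π =
  act-nonascent (act π p) p (act-removesAscent π p) ,
  cong (λ k → ascent π p + (k + 0)) (ascent-false (act π p) p (act-removesAscent π p))

Far : ℕ → ℕ → Set
Far p q = suc p < q ⊎ suc q < p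

far-sym : ∀ {p q} → Far p q → Far q p
far-sym (inj₁ p+1<q) = inj₂ p+1<q
far-sym (inj₂ q+1<p) = inj₁ q+1<p

far⇒≢ : ∀ {p q} → Far p q → p ≢ q
far⇒≢ (inj₁ p+1<q) refl = 1+n≰n (<⇒≤ p+1<q)
far⇒≢ (inj₂ q+1<p) refl = 1+n≰n (<⇒≤ q+1<p)

far⇒≢suc : ∀ {p q} → Far p q → p ≢ suc q
far⇒≢suc (inj₁ p+1<q) refl = 1+n≰n (<⇒≤ (<-trans (n<1+n _) p+1<q))
far⇒≢suc (inj₂ q+1<p) refl = 1+n≰n q+1<p

swap-far : ∀ {p q} → Far p q → swap q p ≡ p
swap-far f = swap-away _ _ (far⇒≢ f) (far⇒≢suc f)

swap-far-suc : ∀ {p q} → Far p q → swap q (suc p) ≡ suc p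
swap-far-suc f = swap-away _ _ (far⇒≢suc (far-sym f) ∘ sym) (far⇒≢ f ∘ suc-injective)

swap-comm : ∀ {p q} → Far p q → ∀ n → swap p (swap q n) ≡ swap q (swap p n)
swap-comm {p} {q} f n with n ≟ p
... | yes refl rewrite swap-far f | swap-here p | swap-far-suc f = refl
... | no n≢p with n ≟ suc p
...   | yes refl rewrite swap-far-suc f | swap-next p | swap-far f = refl
...   | no n≢p+1 with n ≟ q
...     | yes refl rewrite swap-far (far-sym f) | swap-here q | swap-far-suc (far-sym f) = refl
...     | no n≢q with n ≟ suc q
...       | yes refl rewrite swap-far-suc (far-sym f) | swap-next q | swap-far (far-sym f) = refl
...       | no n≢q+1 rewrite swap-away q n n≢q n≢q+1 | swap-away p n n≢p n≢p+1
                           | swap-away q n n≢q n≢q+1 = refl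

act-far : ∀ π {p q} → Far p q → act π p q ≡ π q
act-far π {p} f with π p <ᵇ π (suc p)
... | true  = cong π (swap-far (far-sym f))
... | false = refl

act-far-suc : ∀ π {p q} → Far p q → act π p (suc q) ≡ π (suc q)
act-far-suc π {p} f with π p <ᵇ π (suc p)
... | true  = cong π (swap-far-suc (far-sym f))
... | false = refl

actsAlike-comm : ∀ p q → Far p q → ActsAlike (p ∷ q ∷ []) (q ∷ p ∷ [])
actsAlike-comm p q f .alike π = acts , counts
  where
  q-unmoved : (act π p q <ᵇ act π p (suc q)) ≡ (π q <ᵇ π (suc q))
  q-unmoved = cong₂ _<ᵇ_ (act-far π f) (act-far-suc π f)
  p-unmoved : (act π q p <ᵇ act π q (suc p)) ≡ (π p <ᵇ π (suc p))
  p-unmoved = cong₂ _<ᵇ_ (act-far π (far-sym f)) (act-far-suc π (far-sym f))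
  acts : act (act π p) q ≗ act (act π q) p
  acts n with π p <? π (suc p) | π q <? π (suc q)
  ... | yes p↑ | yes q↑
    rewrite act-ascent (act π p) q (trans q-unmoved (<ᵇ-true q↑)) n
          | act-ascent (act π q) p (trans p-unmoved (<ᵇ-true p↑)) n
          | act-ascent π p (<ᵇ-true p↑) (swap q n) | act-ascent π q (<ᵇ-true q↑) (swap p n)
          = cong π (swap-comm f n)
  ... | yes p↑ | no q↛
    rewrite act-nonascent (act π p) q (trans q-unmoved (<ᵇ-false (≮⇒≥ q↛))) n
          | act-ascent (act π q) p (trans p-unmoved (<ᵇ-true p↑)) n
          | act-ascent π p (<ᵇ-true p↑) n | act-nonascent π q (<ᵇ-false (≮⇒≥ q↛)) (swap p n) = refl
  ... | no p↛ | yes q↑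
    rewrite act-ascent (act π p) q (trans q-unmoved (<ᵇ-true q↑)) n
          | act-nonascent (act π q) p (trans p-unmoved (<ᵇ-false (≮⇒≥ p↛))) n
          | act-nonascent π p (<ᵇ-false (≮⇒≥ p↛)) (swap q n) | act-ascent π q (<ᵇ-true q↑) n = refl
  ... | no p↛ | no q↛
    rewrite act-nonascent (act π p) q (trans q-unmoved (<ᵇ-false (≮⇒≥ q↛))) n
          | act-nonascent (act π q) p (trans p-unmoved (<ᵇ-false (≮⇒≥ p↛))) n
          | act-nonascent π p (<ᵇ-false (≮⇒≥ p↛)) n | act-nonascent π q (<ᵇ-false (≮⇒≥ q↛)) n = refl
  counts : ascent π p + (ascent (act π p) q + 0) ≡ ascent π q + (ascent (act π q) p + 0)
  counts = begin
    ascent π p + (ascent (act π p) q + 0) ≡⟨ cong (λ k → ascent π p + (k + 0))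
                                                  (cong₂ ltBit (act-far π f) (act-far-suc π f)) ⟩
    ascent π p + (ascent π q + 0)         ≡⟨ cong (ascent π p +_) (+-identityʳ _) ⟩
    ascent π p + ascent π q               ≡⟨ +-comm (ascent π p) _ ⟩
    ascent π q + ascent π p               ≡⟨ cong (ascent π q +_) (+-identityʳ _) ⟨
    ascent π q + (ascent π p + 0)         ≡⟨ cong (λ k → ascent π q + (k + 0))
                                                  (cong₂ ltBit (act-far π f′) (act-far-suc π f′)) ⟨
    ascent π q + (ascent (act π q) p + 0) ∎
    where
    open ≡-Reasoning
    f′ = far-sym f

window : Perm → ℕ → Triple
window π p = π p , π (suc p) , π (suc (suc p))

overwrite : Perm → ℕ → Triple → Perm
overwrite π p (x , y , z) n =
  if n ≡ᵇ p then x else if n ≡ᵇ suc p then y else if n ≡ᵇ suc (suc p) then z else π n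

data Position (p : ℕ) : ℕ → Set where
  at₀  : Position p p
  at₁  : Position p (suc p)
  at₂  : Position p (suc (suc p))
  away : ∀ {n} → n ≢ p → n ≢ suc p → n ≢ suc (suc p) → Position p n

position : ∀ p n → Position p n
position p n with n ≟ p
... | yes refl = at₀
... | no n≢p with n ≟ suc p
...   | yes refl = at₁
...   | no n≢p+1 with n ≟ suc (suc p)
...     | yes refl = at₂
...     | no n≢p+2 = away n≢p n≢p+1 n≢p+2

overwrite-at₀ : ∀ π p x y z → overwrite π p (x , y , z) p ≡ x
overwrite-at₀ π p x y z rewrite ≡ᵇ-refl p = refl

overwrite-at₁ : ∀ π p x y z → overwrite π p (x , y , z) (suc p) ≡ y
overwrite-at₁ π p x y z rewrite ≡ᵇ-false (1+n≢n {p}) | ≡ᵇ-refl p = refl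

overwrite-at₂ : ∀ π p x y z → overwrite π p (x , y , z) (suc (suc p)) ≡ z
overwrite-at₂ π p x y z
  rewrite ≡ᵇ-false (2+n≢n p)
        | ≡ᵇ-false (1+n≢n {suc p}) | ≡ᵇ-refl p = refl

overwrite-away : ∀ π p t n → n ≢ p → n ≢ suc p → n ≢ suc (suc p) → overwrite π p t n ≡ π n
overwrite-away π p t n n≢p n≢p+1 n≢p+2
  rewrite ≡ᵇ-false n≢p | ≡ᵇ-false n≢p+1 | ≡ᵇ-false n≢p+2 = refl

window-overwrite : ∀ π p t → window (overwrite π p t) p ≡ t
window-overwrite π p (x , y , z)
  rewrite overwrite-at₀ π p x y z | overwrite-at₁ π p x y z | overwrite-at₂ π p x y z = refl

overwrite-overwrite : ∀ π p t t′ → overwrite (overwrite π p t) p t′ ≗ overwrite π p t′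
overwrite-overwrite π p t (x , y , z) n with position p n
... | at₀ rewrite overwrite-at₀ (overwrite π p t) p x y z | overwrite-at₀ π p x y z = refl
... | at₁ rewrite overwrite-at₁ (overwrite π p t) p x y z | overwrite-at₁ π p x y z = refl
... | at₂ rewrite overwrite-at₂ (overwrite π p t) p x y z | overwrite-at₂ π p x y z = refl
... | away n≢p n≢p+1 n≢p+2
  rewrite overwrite-away (overwrite π p t) p (x , y , z) n n≢p n≢p+1 n≢p+2
        | overwrite-away π p (x , y , z) n n≢p n≢p+1 n≢p+2
        | overwrite-away π p t n n≢p n≢p+1 n≢p+2 = refl

overwrite-window : ∀ π p → π ≗ overwrite π p (window π p)
overwrite-window π p n with position p n
... | at₀ = sym (overwrite-at₀ π p _ _ _)
... | at₁ = sym (overwrite-at₁ π p _ _ _)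
... | at₂ = sym (overwrite-at₂ π p _ _ _)
... | away n≢p n≢p+1 n≢p+2 = sym (overwrite-away π p _ n n≢p n≢p+1 n≢p+2)

swap-window₀ : ∀ π p → π ∘ swap p ≗ overwrite π p (π (suc p) , π p , π (suc (suc p)))
swap-window₀ π p n with position p n
... | at₀ rewrite swap-here p = sym (overwrite-at₀ π p _ _ _)
... | at₁ rewrite swap-next p = sym (overwrite-at₁ π p _ _ _)
... | at₂ rewrite swap-away p (suc (suc p)) (2+n≢n p) 1+n≢n
  = sym (overwrite-at₂ π p _ _ _)
... | away n≢p n≢p+1 n≢p+2 rewrite swap-away p n n≢p n≢p+1
  = sym (overwrite-away π p _ n n≢p n≢p+1 n≢p+2)

swap-window₁ : ∀ π p → π ∘ swap (suc p) ≗ overwrite π p (π p , π (suc (suc p)) , π (suc p))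
swap-window₁ π p n with position p n
... | at₀ rewrite swap-away (suc p) p (n≢1+n p) (n≢2+n p)
  = sym (overwrite-at₀ π p _ _ _)
... | at₁ rewrite swap-here (suc p) = sym (overwrite-at₁ π p _ _ _)
... | at₂ rewrite swap-next (suc p) = sym (overwrite-at₂ π p _ _ _)
... | away n≢p n≢p+1 n≢p+2 rewrite swap-away (suc p) n n≢p+1 n≢p+2
  = sym (overwrite-away π p _ n n≢p n≢p+1 n≢p+2)

act-window₀ : ∀ π p → act π p ≗ overwrite π p (sort₀ (window π p))
act-window₀ π p n with π p <? π (suc p)
... | yes asc rewrite act-ascent π p (<ᵇ-true asc) n | <ᵇ-true asc = swap-window₀ π p n
... | no ¬asc rewrite act-nonascent π p (<ᵇ-false (≮⇒≥ ¬asc)) n | <ᵇ-false (≮⇒≥ ¬asc)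
  = overwrite-window π p n

act-window₁ : ∀ π p → act π (suc p) ≗ overwrite π p (sort₁ (window π p))
act-window₁ π p n with π (suc p) <? π (suc (suc p))
... | yes asc rewrite act-ascent π (suc p) (<ᵇ-true asc) n | <ᵇ-true asc = swap-window₁ π p n
... | no ¬asc rewrite act-nonascent π (suc p) (<ᵇ-false (≮⇒≥ ¬asc)) n | <ᵇ-false (≮⇒≥ ¬asc)
  = overwrite-window π p n

act-overwrite₀ : ∀ π p t → act (overwrite π p t) p ≗ overwrite π p (sort₀ t)
act-overwrite₀ π p t n = begin
  act (overwrite π p t) p n                                       ≡⟨ act-window₀ (overwrite π p t) p n ⟩
  overwrite (overwrite π p t) p (sort₀ (window (overwrite π p t) p)) n
    ≡⟨ cong (λ s → overwrite (overwrite π p t) p (sort₀ s) n) (window-overwrite π p t) ⟩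
  overwrite (overwrite π p t) p (sort₀ t) n                       ≡⟨ overwrite-overwrite π p t (sort₀ t) n ⟩
  overwrite π p (sort₀ t) n                                       ∎
  where open ≡-Reasoning

act-overwrite₁ : ∀ π p t → act (overwrite π p t) (suc p) ≗ overwrite π p (sort₁ t)
act-overwrite₁ π p t n = begin
  act (overwrite π p t) (suc p) n                                 ≡⟨ act-window₁ (overwrite π p t) p n ⟩
  overwrite (overwrite π p t) p (sort₁ (window (overwrite π p t) p)) n
    ≡⟨ cong (λ s → overwrite (overwrite π p t) p (sort₁ s) n) (window-overwrite π p t) ⟩
  overwrite (overwrite π p t) p (sort₁ t) n                       ≡⟨ overwrite-overwrite π p t (sort₁ t) n ⟩
  overwrite π p (sort₁ t) n                                       ∎
  where open ≡-Reasoning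

ascent-overwrite₀ : ∀ π p t → ascent (overwrite π p t) p ≡ asc₀ t
ascent-overwrite₀ π p t = cong asc₀ (window-overwrite π p t)

ascent-overwrite₁ : ∀ π p t → ascent (overwrite π p t) (suc p) ≡ asc₁ t
ascent-overwrite₁ π p t = cong asc₁ (window-overwrite π p t)

module _ (π : Perm) (p : ℕ) where

  private
    t = window π p
    ≗-trans : ∀ {f g h : Perm} → f ≗ g → g ≗ h → f ≗ h
    ≗-trans f≗g g≗h n = trans (f≗g n) (g≗h n)

    act₀ : act π p ≗ overwrite π p (sort₀ t)
    act₀ = act-window₀ π p
    act₀₁ : act (act π p) (suc p) ≗ overwrite π p (sort₁ (sort₀ t))
    act₀₁ = ≗-trans (act-cong (suc p) act₀) (act-overwrite₁ π p (sort₀ t))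
    act₁ : act π (suc p) ≗ overwrite π p (sort₁ t)
    act₁ = act-window₁ π p
    act₁₀ : act (act π (suc p)) p ≗ overwrite π p (sort₀ (sort₁ t))
    act₁₀ = ≗-trans (act-cong p act₁) (act-overwrite₀ π p (sort₁ t))

  actWord-010 : actWord π (p ∷ suc p ∷ p ∷ []) ≗ overwrite π p (sort₀ (sort₁ (sort₀ t)))
  actWord-010 = ≗-trans (act-cong p act₀₁) (act-overwrite₀ π p (sort₁ (sort₀ t)))

  actWord-101 : actWord π (suc p ∷ p ∷ suc p ∷ []) ≗ overwrite π p (sort₁ (sort₀ (sort₁ t)))
  actWord-101 = ≗-trans (act-cong (suc p) act₁₀) (act-overwrite₁ π p (sort₀ (sort₁ t)))

  ascents-010 : ascents π (p ∷ suc p ∷ p ∷ [])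
              ≡ asc₀ t + (asc₁ (sort₀ t) + (asc₀ (sort₁ (sort₀ t)) + 0))
  ascents-010 = cong₂ (λ a b → asc₀ t + (a + (b + 0)))
    (trans (ascent-cong (suc p) act₀) (ascent-overwrite₁ π p (sort₀ t)))
    (trans (ascent-cong p act₀₁) (ascent-overwrite₀ π p (sort₁ (sort₀ t))))

  ascents-101 : ascents π (suc p ∷ p ∷ suc p ∷ [])
              ≡ asc₁ t + (asc₀ (sort₁ t) + (asc₁ (sort₀ (sort₁ t)) + 0))
  ascents-101 = cong₂ (λ a b → asc₁ t + (a + (b + 0)))
    (trans (ascent-cong p act₁) (ascent-overwrite₀ π p (sort₁ t)))
    (trans (ascent-cong (suc p) act₁₀) (ascent-overwrite₁ π p (sort₀ (sort₁ t))))

actsAlike-braidAdjacent : ∀ p → ActsAlike (p ∷ suc p ∷ p ∷ []) (suc p ∷ p ∷ suc p ∷ [])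
actsAlike-braidAdjacent p .alike π = acts , counts
  where
  t = window π p
  acts : actWord π (p ∷ suc p ∷ p ∷ []) ≗ actWord π (suc p ∷ p ∷ suc p ∷ [])
  acts n = trans (actWord-010 π p n)
    (trans (cong (λ s → overwrite π p s n) (sort-braid t)) (sym (actWord-101 π p n)))
  counts : ascents π (p ∷ suc p ∷ p ∷ []) ≡ ascents π (suc p ∷ p ∷ suc p ∷ [])
  counts = begin
    ascents π (p ∷ suc p ∷ p ∷ [])                             ≡⟨ ascents-010 π p ⟩
    asc₀ t + (asc₁ (sort₀ t) + (asc₀ (sort₁ (sort₀ t)) + 0))
      ≡⟨ cong (λ k → asc₀ t + (asc₁ (sort₀ t) + k)) (+-identityʳ _) ⟩
    asc₀ t + (asc₁ (sort₀ t) + asc₀ (sort₁ (sort₀ t)))         ≡⟨ ascents-braid t ⟩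
    asc₁ t + (asc₀ (sort₁ t) + asc₁ (sort₀ (sort₁ t)))
      ≡⟨ cong (λ k → asc₁ t + (asc₀ (sort₁ t) + k)) (+-identityʳ _) ⟨
    asc₁ t + (asc₀ (sort₁ t) + (asc₁ (sort₀ (sort₁ t)) + 0))   ≡⟨ ascents-101 π p ⟨
    ascents π (suc p ∷ p ∷ suc p ∷ [])                         ∎
    where open ≡-Reasoning

actsAlike-braidFar : ∀ {p q} → Far p q → ActsAlike (p ∷ q ∷ p ∷ []) (q ∷ p ∷ q ∷ [])
actsAlike-braidFar {p} {q} f =
  actsAlike-trans (collapse p q f)
    (actsAlike-sym (actsAlike-trans (collapse q p (far-sym f)) (actsAlike-comm q p (far-sym f))))
  where
  collapse : ∀ p q → Far p q → ActsAlike (p ∷ q ∷ p ∷ []) (p ∷ q ∷ [])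
  collapse p q f = actsAlike-trans (actsAlike-inContext (actsAlike-comm q p (far-sym f)) [ p ] [])
                                   (actsAlike-inContext (actsAlike-idem p) [] [ q ])

actsAlike-braid : ∀ p q → ActsAlike (p ∷ q ∷ p ∷ []) (q ∷ p ∷ q ∷ [])
actsAlike-braid p q with <-cmp p q
... | tri≈ _ refl _ = actsAlike-refl
... | tri< p<q _ _ with m≤n⇒m<n∨m≡n p<q
...   | inj₁ p+1<q = actsAlike-braidFar (inj₁ p+1<q)
...   | inj₂ refl  = actsAlike-braidAdjacent p
actsAlike-braid p q | tri> _ _ q<p with m≤n⇒m<n∨m≡n q<p
...   | inj₁ q+1<p = actsAlike-braidFar (inj₂ q+1<p)
...   | inj₂ refl  = actsAlike-sym (actsAlike-braidAdjacent q)

step⇒actsAlike : ∀ {x y} → Step x y → ActsAlike x y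
step⇒actsAlike (comm u v p q f) = actsAlike-inContext (actsAlike-comm p q f) u v
step⇒actsAlike (braid u v p q)  = actsAlike-inContext (actsAlike-braid p q) u v
step⇒actsAlike (idem u v p)     = actsAlike-inContext (actsAlike-idem p) u v

heckeEq⇒actsAlike : ∀ {x y} → HeckeEq x y → ActsAlike x y
heckeEq⇒actsAlike ε                = actsAlike-refl
heckeEq⇒actsAlike (inj₁ s ◅ x~y)   = actsAlike-trans (step⇒actsAlike s) (heckeEq⇒actsAlike x~y)
heckeEq⇒actsAlike (inj₂ s ◅ x~y)   = actsAlike-trans (actsAlike-sym (step⇒actsAlike s)) (heckeEq⇒actsAlike x~y)

heckeEq⇒demazure : ∀ {x y} → HeckeEq x y → demazure x ≗ demazure y
heckeEq⇒demazure x~y = proj₁ (heckeEq⇒actsAlike x~y .alike id)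

heckeEq⇒heckeLength : ∀ {x y} → HeckeEq x y → heckeLength x ≡ heckeLength y
heckeEq⇒heckeLength x~y = proj₂ (heckeEq⇒actsAlike x~y .alike id)

step⇒heckeEq : ∀ {x y} → Step x y → HeckeEq x y
step⇒heckeEq s = inj₁ s ◅ ε

≡⇒heckeEq : ∀ {x y} → x ≡ y → HeckeEq x y
≡⇒heckeEq refl = ε

heckeEq-sym : ∀ {x y} → HeckeEq x y → HeckeEq y x
heckeEq-sym = Star.reverse ⊎-swap

++-regroup : ∀ (u u′ s v′ v : Word) → u ++ (u′ ++ s ++ v′) ++ v ≡ (u ++ u′) ++ s ++ (v′ ++ v)
++-regroup u u′ s v′ v
  rewrite ++-assoc u′ (s ++ v′) v | ++-assoc s v′ v | ++-assoc u u′ (s ++ (v′ ++ v)) = refl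

step-inContext : ∀ {x y} → Step x y → ∀ u v → Step (u ++ x ++ v) (u ++ y ++ v)
step-inContext (comm u′ v′ p q f) u v =
  subst₂ Step (sym (++-regroup u u′ (p ∷ q ∷ []) v′ v)) (sym (++-regroup u u′ (q ∷ p ∷ []) v′ v))
    (comm (u ++ u′) (v′ ++ v) p q f)
step-inContext (braid u′ v′ p q) u v =
  subst₂ Step (sym (++-regroup u u′ (p ∷ q ∷ p ∷ []) v′ v))
              (sym (++-regroup u u′ (q ∷ p ∷ q ∷ []) v′ v))
    (braid (u ++ u′) (v′ ++ v) p q)
step-inContext (idem u′ v′ p) u v =
  subst₂ Step (sym (++-regroup u u′ (p ∷ p ∷ []) v′ v)) (sym (++-regroup u u′ (p ∷ []) v′ v))
    (idem (u ++ u′) (v′ ++ v) p)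

heckeEq-inContext : ∀ {x y} → HeckeEq x y → ∀ u v → HeckeEq (u ++ x ++ v) (u ++ y ++ v)
heckeEq-inContext x~y u v = gmap (λ w → u ++ w ++ v) inContext x~y
  where
  inContext : ∀ {a b} → SymStep a b → SymStep (u ++ a ++ v) (u ++ b ++ v)
  inContext (inj₁ s) = inj₁ (step-inContext s u v)
  inContext (inj₂ s) = inj₂ (step-inContext s u v)

heckeEq-++ʳ : ∀ {x y} v → HeckeEq x y → HeckeEq (x ++ v) (y ++ v)
heckeEq-++ʳ v x~y = heckeEq-inContext x~y [] v

heckeEq-++ˡ : ∀ {x y} u → HeckeEq x y → HeckeEq (u ++ x) (u ++ y)
heckeEq-++ˡ {x} {y} u x~y =
  subst₂ HeckeEq (cong (u ++_) (++-identityʳ x)) (cong (u ++_) (++-identityʳ y))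
    (heckeEq-inContext x~y u [])

reverse-++-++ : ∀ (u : Word) s v → reverse (u ++ s ++ v) ≡ reverse v ++ reverse s ++ reverse u
reverse-++-++ u s v
  rewrite reverse-++ u (s ++ v) | reverse-++ s v | ++-assoc (reverse v) (reverse s) (reverse u) = refl

step-reverse : ∀ {x y} → Step x y → Step (reverse x) (reverse y)
step-reverse (comm u v p q f) =
  subst₂ Step (sym (reverse-++-++ u (p ∷ q ∷ []) v)) (sym (reverse-++-++ u (q ∷ p ∷ []) v))
    (comm (reverse v) (reverse u) q p (far-sym f))
step-reverse (braid u v p q) =
  subst₂ Step (sym (reverse-++-++ u (p ∷ q ∷ p ∷ []) v)) (sym (reverse-++-++ u (q ∷ p ∷ q ∷ []) v))
    (braid (reverse v) (reverse u) p q)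
step-reverse (idem u v p) =
  subst₂ Step (sym (reverse-++-++ u (p ∷ p ∷ []) v)) (sym (reverse-++-++ u (p ∷ []) v))
    (idem (reverse v) (reverse u) p)

heckeEq-reverse : ∀ {x y} → HeckeEq x y → HeckeEq (reverse x) (reverse y)
heckeEq-reverse = gmap reverse reverseStep
  where
  reverseStep : ∀ {a b} → SymStep a b → SymStep (reverse a) (reverse b)
  reverseStep (inj₁ s) = inj₁ (step-reverse s)
  reverseStep (inj₂ s) = inj₂ (step-reverse s)

-- The exchange property

Descent : Perm → ℕ → Set
Descent π a = π (suc a) ≤ π a

descent-cong : ∀ {π σ} a → π ≗ σ → Descent π a → Descent σ a
descent-cong a π≗σ d rewrite π≗σ a | π≗σ (suc a) = d

record EndsIn (p : Word) (a : ℕ) : Set where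
  constructor endsIn
  field
    prefix  : Word
    equiv   : HeckeEq p (prefix ++ [ a ])
    shorter : length prefix < length p

length-∷ʳ : ∀ (w : Word) b → length (w ++ [ b ]) ≡ suc (length w)
length-∷ʳ w b = trans (length-++ w) (+-comm (length w) 1)

idem-∷ʳ : ∀ r a → HeckeEq ((r ++ [ a ]) ++ [ a ]) (r ++ [ a ])
idem-∷ʳ r a = subst (λ w → HeckeEq w (r ++ [ a ])) (sym (++-assoc r [ a ] [ a ]))
                (step⇒heckeEq (idem r [] a))

comm-∷ʳ : ∀ r a b → Far a b → HeckeEq ((r ++ [ a ]) ++ [ b ]) ((r ++ [ b ]) ++ [ a ])
comm-∷ʳ r a b f = subst₂ HeckeEq (sym (++-assoc r [ a ] [ b ])) (sym (++-assoc r [ b ] [ a ]))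
                    (step⇒heckeEq (comm r [] a b f))

braid-∷ʳ : ∀ r a b → HeckeEq (((r ++ [ a ]) ++ [ b ]) ++ [ a ]) ((r ++ b ∷ a ∷ []) ++ [ b ])
braid-∷ʳ r a b = subst₂ HeckeEq
  (sym (trans (cong (_++ [ a ]) (++-assoc r [ a ] [ b ])) (++-assoc r (a ∷ b ∷ []) [ a ])))
  (sym (++-assoc r (b ∷ a ∷ []) [ b ]))
  (step⇒heckeEq (braid r [] a b))

length-<-∷ʳ : ∀ (w : Word) b → length w < length (w ++ [ b ])
length-<-∷ʳ w b = ≤-reflexive (sym (length-∷ʳ w b))

braidUp-descents : ∀ ρ a → ρ (suc a) < ρ (suc (suc a)) → Descent (act ρ (suc a)) a →
  Descent ρ a × (∀ ρ′ → ρ ≗ act ρ′ a → ρ′ a < ρ′ (suc a) → Descent ρ′ (suc a))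
braidUp-descents ρ a asc d = ≤-trans (<⇒≤ asc) outer , inner
  where
  e = <ᵇ-true asc
  outer : ρ (suc (suc a)) ≤ ρ a
  outer = subst₂ _≤_ (trans (act-ascent ρ (suc a) e (suc a)) (cong ρ (swap-here (suc a))))
                     (trans (act-ascent ρ (suc a) e a) (cong ρ (swap-away (suc a) a (n≢1+n a) (n≢2+n a))))
                     d
  inner : ∀ ρ′ → ρ ≗ act ρ′ a → ρ′ a < ρ′ (suc a) → Descent ρ′ (suc a)
  inner ρ′ ρ≗ asc′ = subst₂ _≤_
    (trans (ρ≗ (suc (suc a))) (trans (act-ascent ρ′ a e′ (suc (suc a)))
                                     (cong ρ′ (swap-away a (suc (suc a)) (2+n≢n a) 1+n≢n))))
    (trans (ρ≗ a) (trans (act-ascent ρ′ a e′ a) (cong ρ′ (swap-here a))))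
    outer
    where e′ = <ᵇ-true asc′

braidDown-descents : ∀ ρ b → ρ b < ρ (suc b) → Descent (act ρ b) (suc b) →
  Descent ρ (suc b) × (∀ ρ′ → ρ ≗ act ρ′ (suc b) → ρ′ (suc b) < ρ′ (suc (suc b)) → Descent ρ′ b)
braidDown-descents ρ b asc d = ≤-trans outer (<⇒≤ asc) , inner
  where
  e = <ᵇ-true asc
  outer : ρ (suc (suc b)) ≤ ρ b
  outer = subst₂ _≤_ (trans (act-ascent ρ b e (suc (suc b)))
                            (cong ρ (swap-away b (suc (suc b)) (2+n≢n b) 1+n≢n)))
                     (trans (act-ascent ρ b e (suc b)) (cong ρ (swap-next b)))
                     d
  inner : ∀ ρ′ → ρ ≗ act ρ′ (suc b) → ρ′ (suc b) < ρ′ (suc (suc b)) → Descent ρ′ b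
  inner ρ′ ρ≗ asc′ = subst₂ _≤_
    (trans (ρ≗ (suc (suc b))) (trans (act-ascent ρ′ (suc b) e′ (suc (suc b))) (cong ρ′ (swap-next (suc b)))))
    (trans (ρ≗ b) (trans (act-ascent ρ′ (suc b) e′ b) (cong ρ′ (swap-away (suc b) b (n≢1+n b) (n≢2+n b)))))
    outer
    where e′ = <ᵇ-true asc′

far-descent : ∀ ρ {a b} → Far a b → ρ b < ρ (suc b) → Descent (act ρ b) a → Descent ρ a
far-descent ρ {a} {b} f asc = subst₂ _≤_
  (trans (act-ascent ρ b (<ᵇ-true asc) (suc a)) (cong ρ (swap-far-suc f)))
  (trans (act-ascent ρ b (<ᵇ-true asc) a) (cong ρ (swap-far f)))

module ExchangeStep (n : ℕ)
  (exchange-IH : ∀ p a → length p ≤ n → Descent (demazure p) a → EndsIn p a) where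

  absorb : ∀ q c → length q ≤ n → Descent (demazure q) c → HeckeEq (q ++ [ c ]) q
  absorb q c q≤n d = heckeEq-++ʳ [ c ] equiv ◅◅ idem-∷ʳ prefix c ◅◅ heckeEq-sym equiv
    where open EndsIn (exchange-IH q c q≤n d)

  shortcut : ∀ {q q′} b a → HeckeEq q q′ → length q′ < length q → length q ≤ n →
             Descent (act (demazure q) b) a → EndsIn (q ++ [ b ]) a
  shortcut {q} {q′} b a q~q′ q′<q q≤n d =
    endsIn prefix (heckeEq-++ʳ [ b ] q~q′ ◅◅ equiv)
      (<-≤-trans shorter (≤-trans (≤-reflexive (length-∷ʳ q′ b))
                                  (≤-trans q′<q (<⇒≤ (length-<-∷ʳ q b)))))
    where
    d′ : Descent (demazure (q′ ++ [ b ])) a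
    d′ = descent-cong a (λ k → trans (act-cong b (heckeEq⇒demazure q~q′) k) (sym (demazure-∷ʳ q′ b k))) d
    open EndsIn (exchange-IH (q′ ++ [ b ]) a
                   (≤-trans (≤-reflexive (length-∷ʳ q′ b)) (≤-trans q′<q q≤n)) d′)

  exchange-adjacent : ∀ q b a → length q ≤ n → Descent (demazure q) a →
    (∀ ρ′ → demazure q ≗ act ρ′ a → ρ′ a < ρ′ (suc a) → Descent ρ′ b) →
    Descent (act (demazure q) b) a → EndsIn (q ++ [ b ]) a
  exchange-adjacent q b a q≤n dρ inner d = continue (exchange-IH q a q≤n dρ)
    where
    continue : EndsIn q a → EndsIn (q ++ [ b ]) a
    continue (endsIn q′ q~q′a q′<q) with demazure q′ a <? demazure q′ (suc a)
    ... | no ¬asc′ =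
      shortcut b a (q~q′a ◅◅ absorb q′ a (≤-trans (<⇒≤ q′<q) q≤n) (≮⇒≥ ¬asc′)) q′<q q≤n d
    ... | yes asc′ = endsIn (q″ ++ a ∷ b ∷ []) chain shorter′
      where
      ρ≗ : demazure q ≗ act (demazure q′) a
      ρ≗ k = trans (heckeEq⇒demazure q~q′a k) (demazure-∷ʳ q′ a k)
      open EndsIn (exchange-IH q′ b (≤-trans (<⇒≤ q′<q) q≤n) (inner (demazure q′) ρ≗ asc′))
        renaming (prefix to q″; equiv to q′~q″b; shorter to q″<q′)
      chain : HeckeEq (q ++ [ b ]) ((q″ ++ a ∷ b ∷ []) ++ [ a ])
      chain = heckeEq-++ʳ [ b ] q~q′a ◅◅ heckeEq-++ʳ [ b ] (heckeEq-++ʳ [ a ] q′~q″b)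
                ◅◅ braid-∷ʳ q″ b a
      shorter′ : length (q″ ++ a ∷ b ∷ []) < length (q ++ [ b ])
      shorter′ rewrite length-++ q″ {a ∷ b ∷ []} | length-∷ʳ q b | +-comm (length q″) 2
        = s≤s (≤-trans (s≤s q″<q′) q′<q)

  exchange-far : ∀ q b a → length q ≤ n → Far a b → demazure q b < demazure q (suc b) →
                 Descent (act (demazure q) b) a → EndsIn (q ++ [ b ]) a
  exchange-far q b a q≤n f asc d =
    endsIn (prefix ++ [ b ]) (heckeEq-++ʳ [ b ] equiv ◅◅ comm-∷ʳ prefix a b f) shorter′
    where
    open EndsIn (exchange-IH q a q≤n (far-descent (demazure q) f asc d))
    shorter′ : length (prefix ++ [ b ]) < length (q ++ [ b ])
    shorter′ rewrite length-∷ʳ prefix b | length-∷ʳ q b = s≤s shorter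

  exchange-∷ʳ : ∀ q b a → length q ≤ n → Descent (act (demazure q) b) a → EndsIn (q ++ [ b ]) a
  exchange-∷ʳ q b a q≤n d with demazure q b <? demazure q (suc b)
  ... | no ¬asc = endsIn prefix (absorb q b q≤n (≮⇒≥ ¬asc) ◅◅ equiv) (<-trans shorter (length-<-∷ʳ q b))
    where
    unmoved : act (demazure q) b ≗ demazure q
    unmoved = act-nonascent (demazure q) b (<ᵇ-false (≮⇒≥ ¬asc))
    open EndsIn (exchange-IH q a q≤n (descent-cong a unmoved d))
  ... | yes asc with <-cmp a b
  ...   | tri≈ _ refl _ = endsIn q ε (length-<-∷ʳ q b)
  ...   | tri< a<b _ _ with m≤n⇒m<n∨m≡n a<b
  ...     | inj₁ a+1<b = exchange-far q b a q≤n (inj₁ a+1<b) asc d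
  ...     | inj₂ refl  = uncurry (exchange-adjacent q b a q≤n) (braidUp-descents (demazure q) a asc d) d
  exchange-∷ʳ q b a q≤n d | yes asc | tri> _ _ b<a with m≤n⇒m<n∨m≡n b<a
  ...     | inj₁ b+1<a = exchange-far q b a q≤n (inj₂ b+1<a) asc d
  ...     | inj₂ refl  = uncurry (exchange-adjacent q b a q≤n) (braidDown-descents (demazure q) b asc d) d

exchange : ∀ n p a → length p ≤ n → Descent (demazure p) a → EndsIn p a
exchange n p a p≤n d with initLast p
exchange n       .[]            a p≤n d | []      = ⊥-elim (1+n≰n d)
exchange zero    .(q ++ [ b ]) a p≤0 d | q ∷ʳ′ b = ⊥-elim (n≮0 (subst (_≤ 0) (length-∷ʳ q b) p≤0))
exchange (suc n) .(q ++ [ b ]) a p≤n d | q ∷ʳ′ b =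
  ExchangeStep.exchange-∷ʳ n (exchange n) q b a
    (≤-pred (≤-trans (≤-reflexive (sym (length-∷ʳ q b))) p≤n)) (descent-cong a (demazure-∷ʳ q b) d)

descent-absorbs : ∀ q c → Descent (demazure q) c → HeckeEq (q ++ [ c ]) q
descent-absorbs q c = ExchangeStep.absorb (length q) (exchange (length q)) q c ≤-refl

-- Reduced words and full commutativity

record ReducedSuffix (P S : Word) : Set where
  constructor reducedSuffix
  field
    suffix  : Word
    equiv   : HeckeEq (P ++ S) (P ++ suffix)
    reduced : ascents (demazure P) suffix ≡ length suffix

reduceSuffix : ∀ P S → ReducedSuffix P S
reduceSuffix P []      = reducedSuffix [] ε refl
reduceSuffix P (b ∷ S) with demazure P b <? demazure P (suc b)
... | yes asc = reducedSuffix (b ∷ suffix)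
  (≡⇒heckeEq (sym (++-assoc P [ b ] S)) ◅◅ equiv ◅◅ ≡⇒heckeEq (++-assoc P [ b ] suffix))
  (cong₂ _+_ (ascent-true (demazure P) b (<ᵇ-true asc))
             (trans (ascents-cong suffix (λ k → sym (demazure-∷ʳ P b k))) reduced))
  where open ReducedSuffix (reduceSuffix (P ++ [ b ]) S)
... | no ¬asc = reducedSuffix suffix
  (≡⇒heckeEq (sym (++-assoc P [ b ] S)) ◅◅ heckeEq-++ʳ S (descent-absorbs P b (≮⇒≥ ¬asc)) ◅◅ equiv)
  reduced
  where open ReducedSuffix (reduceSuffix P S)

heckeLength-reverse≤ : ∀ x → heckeLength (reverse x) ≤ heckeLength x
heckeLength-reverse≤ x = begin
  heckeLength (reverse x)       ≡⟨ heckeEq⇒heckeLength (heckeEq-reverse equiv) ⟩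
  heckeLength (reverse suffix)  ≤⟨ ascents≤length _ (reverse suffix) ⟩
  length (reverse suffix)       ≡⟨ length-reverse suffix ⟩
  length suffix                 ≡⟨ reduced ⟨
  heckeLength suffix            ≡⟨ heckeEq⇒heckeLength equiv ⟨
  heckeLength x                 ∎
  where
  open ≤-Reasoning
  open ReducedSuffix (reduceSuffix [] x)

heckeLength-reverse : ∀ x → heckeLength (reverse x) ≡ heckeLength x
heckeLength-reverse x = ≤-antisym (heckeLength-reverse≤ x)
  (subst (λ w → heckeLength w ≤ heckeLength (reverse x)) (reverse-involutive x)
         (heckeLength-reverse≤ (reverse x)))

heckeLength-010 : ∀ i → heckeLength (i ∷ suc i ∷ i ∷ []) ≡ 3
heckeLength-010 i rewrite ascents-010 id i
  | <ᵇ-true (n<1+n i) | <ᵇ-true (m<n⇒m<1+n (n<1+n i)) | <ᵇ-true (n<1+n (suc i)) = refl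

heckeLength-101 : ∀ i → heckeLength (suc i ∷ i ∷ suc i ∷ []) ≡ 3
heckeLength-101 i rewrite ascents-101 id i
  | <ᵇ-true (n<1+n i) | <ᵇ-true (m<n⇒m<1+n (n<1+n i)) | <ᵇ-true (n<1+n (suc i)) = refl

reduced⇒minimal : ∀ {W v} → HeckeEq W v → heckeLength v ≡ length v → MinimalIn W v
reduced⇒minimal {W} {v} W~v reduced = W~v , minimal
  where
  minimal : ∀ u → HeckeEq W u → length v ≤ length u
  minimal u W~u = begin
    length v          ≡⟨ reduced ⟨
    heckeLength v     ≡⟨ heckeEq⇒heckeLength (heckeEq-sym W~v ◅◅ W~u) ⟩
    heckeLength u     ≤⟨ ascents≤length _ u ⟩
    length u          ∎
    where open ≤-Reasoning

record ReducedPrefix (U s : Word) : Set where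
  constructor reducedPrefix
  field
    prefix  : Word
    equiv   : HeckeEq (U ++ s) (prefix ++ s)
    reduced : heckeLength (prefix ++ s) ≡ length (prefix ++ s)

reducePrefix : ∀ U s → heckeLength s ≡ length s → ReducedPrefix U s
reducePrefix U s s-reduced = reducedPrefix U′ Us~U′s U′s-reduced
  where
  open ReducedSuffix (reduceSuffix (reverse s) (reverse U)) renaming (suffix to Ū′)
  U′ = reverse Ū′
  reverse-sŪ : ∀ Ū → reverse (reverse s ++ Ū) ≡ reverse Ū ++ s
  reverse-sŪ Ū = trans (reverse-++ (reverse s) Ū) (cong (reverse Ū ++_) (reverse-involutive s))
  Us~U′s : HeckeEq (U ++ s) (U′ ++ s)
  Us~U′s = subst₂ HeckeEq (trans (reverse-sŪ (reverse U)) (cong (_++ s) (reverse-involutive U)))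
                          (reverse-sŪ Ū′) (heckeEq-reverse equiv)
  U′s-reduced : heckeLength (U′ ++ s) ≡ length (U′ ++ s)
  U′s-reduced = begin
    heckeLength (U′ ++ s)                                      ≡⟨ cong heckeLength (reverse-sŪ Ū′) ⟨
    heckeLength (reverse (reverse s ++ Ū′))                    ≡⟨ heckeLength-reverse (reverse s ++ Ū′) ⟩
    heckeLength (reverse s ++ Ū′)                              ≡⟨ ascents-++ _ (reverse s) Ū′ ⟩
    heckeLength (reverse s) + ascents (demazure (reverse s)) Ū′
      ≡⟨ cong₂ _+_ (trans (heckeLength-reverse s) s-reduced) reduced ⟩
    length s + length Ū′                                       ≡⟨ +-comm (length s) _ ⟩
    length Ū′ + length s                                       ≡⟨ cong (_+ length s) (length-reverse Ū′) ⟨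
    length U′ + length s                                       ≡⟨ length-++ U′ ⟨
    length (U′ ++ s)                                           ∎
    where open ≡-Reasoning

record ReducedContext (U s V : Word) : Set where
  constructor reducedContext
  field
    U′ V′   : Word
    equiv   : HeckeEq (U ++ s ++ V) (U′ ++ s ++ V′)
    reduced : heckeLength (U′ ++ s ++ V′) ≡ length (U′ ++ s ++ V′)

extend-reducedFactor : ∀ U s V → heckeLength s ≡ length s → ReducedContext U s V
extend-reducedFactor U s V s-reduced = reducedContext prefix suffix
  (≡⇒heckeEq (sym (++-assoc U s V)) ◅◅ heckeEq-++ʳ V Us~ ◅◅ U′sV~ ◅◅ ≡⇒heckeEq (++-assoc prefix s suffix))
  (begin
    heckeLength (prefix ++ s ++ suffix)                             ≡⟨ cong heckeLength (++-assoc prefix s suffix) ⟨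
    heckeLength ((prefix ++ s) ++ suffix)                           ≡⟨ ascents-++ _ (prefix ++ s) suffix ⟩
    heckeLength (prefix ++ s) + ascents (demazure (prefix ++ s)) suffix ≡⟨ cong₂ _+_ U′s-reduced V′-reduced ⟩
    length (prefix ++ s) + length suffix                            ≡⟨ length-++ (prefix ++ s) ⟨
    length ((prefix ++ s) ++ suffix)                                ≡⟨ cong length (++-assoc prefix s suffix) ⟩
    length (prefix ++ s ++ suffix)                                  ∎)
  where
  open ≡-Reasoning
  open ReducedPrefix (reducePrefix U s s-reduced) renaming (equiv to Us~; reduced to U′s-reduced)
  open ReducedSuffix (reduceSuffix (prefix ++ s) V) renaming (equiv to U′sV~; reduced to V′-reduced)

containsBraidPattern-inContext : ∀ U s V → ContainsBraidPattern s → ContainsBraidPattern (U ++ s ++ V)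
containsBraidPattern-inContext U s V (a , b , i , inj₁ refl) =
  U ++ a , b ++ V , i , inj₁ (++-regroup U a (i ∷ suc i ∷ i ∷ []) b V)
containsBraidPattern-inContext U s V (a , b , i , inj₂ refl) =
  U ++ a , b ++ V , i , inj₂ (++-regroup U a (suc i ∷ i ∷ suc i ∷ []) b V)

fullyCommutative-noReducedBraid : ∀ {W} U s V → FullyCommutative W → HeckeEq W (U ++ s ++ V) →
  heckeLength s ≡ length s → ¬ ContainsBraidPattern s
fullyCommutative-noReducedBraid U s V fc W~UsV s-reduced has-pattern =
  fc (U′ ++ s ++ V′) (reduced⇒minimal (W~UsV ◅◅ equiv) reduced)
     (containsBraidPattern-inContext U′ s V′ has-pattern)
  where open ReducedContext (extend-reducedFactor U s V s-reduced)

fullyCommutative-no010 : ∀ {W} U V i → FullyCommutative W → ¬ HeckeEq W (U ++ i ∷ suc i ∷ i ∷ V)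
fullyCommutative-no010 U V i fc W~ =
  fullyCommutative-noReducedBraid U (i ∷ suc i ∷ i ∷ []) V fc W~ (heckeLength-010 i)
    ([] , [] , i , inj₁ refl)

fullyCommutative-no101 : ∀ {W} U V i → FullyCommutative W → ¬ HeckeEq W (U ++ suc i ∷ i ∷ suc i ∷ V)
fullyCommutative-no101 U V i fc W~ =
  fullyCommutative-noReducedBraid U (suc i ∷ i ∷ suc i ∷ []) V fc W~ (heckeLength-101 i)
    ([] , [] , i , inj₂ refl)

-- Consecutive decreasing factors of a fully commutative word

Decreasing : Word → Set
Decreasing = AllPairs _>_

record Obstruction (F A : Word) (y : ℕ) : Set where
  field
    1+y∈F : suc y ∈ F
    y∈F   : y ∈ F
    1+y∈A : suc y ∈ A
    y∈A   : y ∈ A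
    gap   : ∀ p → p ∈ F → p < y → suc p < y

commute-letter : ∀ p Y → All (Far p) Y → HeckeEq (p ∷ Y) (Y ++ [ p ])
commute-letter p []      []       = ε
commute-letter p (q ∷ Y) (f ∷ fs) = step⇒heckeEq (comm [] Y p q f) ◅◅ heckeEq-++ˡ [ q ] (commute-letter p Y fs)

commute-block : ∀ X Y → All (λ p → All (Far p) Y) X → HeckeEq (X ++ Y) (Y ++ X)
commute-block []      Y []       = ≡⇒heckeEq (sym (++-identityʳ Y))
commute-block (p ∷ X) Y (f ∷ fs) =
  heckeEq-++ˡ [ p ] (commute-block X Y fs) ◅◅ heckeEq-++ʳ X (commute-letter p Y f)
  ◅◅ ≡⇒heckeEq (++-assoc Y [ p ] X)

commute-block-++ : ∀ X Y Z → All (λ p → All (Far p) Y) X → HeckeEq (X ++ Y ++ Z) (Y ++ X ++ Z)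
commute-block-++ X Y Z far =
  subst₂ HeckeEq (++-assoc X Y Z) (++-assoc Y X Z) (heckeEq-++ʳ Z (commute-block X Y far))

decreasing-head : ∀ {k P} → Decreasing P → All (_< suc k) P → k ∈ P → Σ Word λ P′ → P ≡ k ∷ P′
decreasing-head {k} {p ∷ P′} (p>P′ ∷ _) (p<1+k ∷ _) k∈P =
  P′ , cong (_∷ P′) (≤-antisym (≤-pred p<1+k) (k≤p k∈P))
  where
  k≤p : k ∈ p ∷ P′ → k ≤ p
  k≤p (here refl)  = ≤-refl
  k≤p (there k∈P′) = <⇒≤ (All.lookup p>P′ k∈P′)

record PairSplit (y : ℕ) (F : Word) : Set where
  field
    above below : Word
    split       : F ≡ above ++ suc y ∷ y ∷ below
    above>      : All (suc y <_) above
    below<      : All (_< y) below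

pairSplit : ∀ y F → Decreasing F → suc y ∈ F → y ∈ F → PairSplit y F
pairSplit y (x ∷ F) (x>F ∷ F↓) (here refl) (here y≡1+y) = ⊥-elim (n≢1+n y y≡1+y)
pairSplit y (x ∷ F) (x>F ∷ F↓) (here refl) (there y∈F) with decreasing-head F↓ x>F y∈F
... | below , refl = record
  { above = [] ; below = below ; split = refl ; above> = [] ; below< = AllPairs.head F↓ }
pairSplit y (x ∷ F) (x>F ∷ F↓) (there 1+y∈F) y∈xF = record
  { above = x ∷ above ; below = below ; split = cong (x ∷_) split
  ; above> = All.lookup x>F 1+y∈F ∷ above> ; below< = below< }
  where
  y∈F : y ∈ F
  y∈F = tail (λ y≡x → <-irrefl y≡x (<-trans (n<1+n y) (All.lookup x>F 1+y∈F))) y∈xF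
  open PairSplit (pairSplit y F F↓ 1+y∈F y∈F)

data TopOf (y : ℕ) (A : Word) : Set where
  clear  : All (suc (suc y) <_) A → TopOf y A
  ending : ∀ A′ → A ≡ A′ ++ [ suc (suc y) ] → All (suc (suc y) <_) A′ → TopOf y A

topOf : ∀ y A → Decreasing A → All (suc y <_) A → TopOf y A
topOf y []      _          []             = clear []
topOf y (a ∷ A) (a>A ∷ A↓) (1+y<a ∷ 1+y<A) with topOf y A A↓ 1+y<A
... | ending A′ refl 2+y<A′ = ending (a ∷ A′) refl (All.lookup a>A (∈-++⁺ʳ A′ (here refl)) ∷ 2+y<A′)
... | clear 2+y<A with m≤n⇒m<n∨m≡n 1+y<a
...   | inj₁ 2+y<a = clear (2+y<a ∷ 2+y<A)
...   | inj₂ refl with A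
...     | []    = ending [] refl []
...     | b ∷ _ = ⊥-elim (<-asym (All.head 2+y<A) (All.head a>A))

module _ (y : ℕ) where

  private
    K : Word
    K = suc y ∷ y ∷ []

    K-far : ∀ {A} → All (suc (suc y) <_) A → All (λ p → All (Far p) A) K
    K-far 2+y≪A = All.map inj₁ 2+y≪A ∷ All.map (λ 2+y<a → inj₁ (<-trans (n<1+n (suc y)) 2+y<a)) 2+y≪A ∷ []

  regroup-factors : ∀ u F₁ F₂ A₁ A₂ w →
    u ++ (F₁ ++ K ++ F₂) ++ (A₁ ++ K ++ A₂) ++ w ≡ (u ++ F₁) ++ K ++ F₂ ++ A₁ ++ K ++ A₂ ++ w
  regroup-factors u F₁ F₂ A₁ A₂ w =
    solve 7 (λ u F₁ K F₂ A₁ A₂ w → u ⊕ ((F₁ ⊕ (K ⊕ F₂)) ⊕ ((A₁ ⊕ (K ⊕ A₂)) ⊕ w))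
                                 ⊜ (u ⊕ F₁) ⊕ (K ⊕ (F₂ ⊕ (A₁ ⊕ (K ⊕ (A₂ ⊕ w))))))
            refl u F₁ K F₂ A₁ A₂ w

  lowLetters-commute : ∀ P F A R → All (λ p → suc p < y) F → All (suc y <_) A →
    HeckeEq (P ++ K ++ F ++ A ++ K ++ R) (P ++ K ++ A ++ K ++ F ++ R)
  lowLetters-commute P F A R F≪y y≪A = heckeEq-++ˡ P (heckeEq-++ˡ K (subst₂ HeckeEq
    (cong (F ++_) (++-assoc A K R)) (++-assoc A K (F ++ R))
    (commute-block-++ F (A ++ K) R F-far)))
    where
    F-far : All (λ p → All (Far p) (A ++ K)) F
    F-far = All.map (λ 1+p<y → ++⁺ (All.map (λ 1+y<a → inj₁ (<-trans 1+p<y (<-trans (n<1+n y) 1+y<a))) y≪A)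
                                   (inj₁ (<-trans 1+p<y (n<1+n y)) ∷ inj₁ 1+p<y ∷ []))
                    F≪y

  highLetters-commute : ∀ P A R → All (suc (suc y) <_) A →
    HeckeEq (P ++ K ++ A ++ K ++ R) ((P ++ A) ++ suc y ∷ y ∷ suc y ∷ y ∷ R)
  highLetters-commute P A R 2+y≪A = subst (HeckeEq (P ++ K ++ A ++ K ++ R)) (sym (++-assoc P A (K ++ K ++ R)))
    (heckeEq-++ˡ P (commute-block-++ K A (K ++ R) (K-far 2+y≪A)))

  highLetters-braid : ∀ P A R → All (suc (suc y) <_) A →
    HeckeEq (P ++ K ++ (A ++ [ suc (suc y) ]) ++ K ++ R)
            ((P ++ A ++ suc y ∷ suc (suc y) ∷ []) ++ y ∷ suc y ∷ y ∷ R)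
  highLetters-braid P A R 2+y≪A = begin
    P ++ K ++ (A ++ [ suc (suc y) ]) ++ K ++ R
      ≡⟨ cong (λ X → P ++ K ++ X) (++-assoc A [ suc (suc y) ] (K ++ R)) ⟩
    P ++ K ++ A ++ suc (suc y) ∷ K ++ R
      ⟶*⟨ heckeEq-++ˡ P (commute-block-++ K A (suc (suc y) ∷ K ++ R) (K-far 2+y≪A)) ⟩
    P ++ A ++ K ++ suc (suc y) ∷ K ++ R
      ≡⟨ solve 6 (λ P A Y₁ Y₀ T KR → P ⊕ (A ⊕ ((Y₁ ⊕ Y₀) ⊕ (T ⊕ KR)))
                                   ⊜ (P ⊕ (A ⊕ Y₁)) ⊕ (Y₀ ⊕ (T ⊕ KR)))
               refl P A [ suc y ] [ y ] [ suc (suc y) ] (K ++ R) ⟩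
    (P ++ A ++ [ suc y ]) ++ y ∷ suc (suc y) ∷ K ++ R
      ⟶⟨ inj₁ (comm (P ++ A ++ [ suc y ]) (K ++ R) y (suc (suc y)) (inj₁ ≤-refl)) ⟩
    (P ++ A ++ [ suc y ]) ++ suc (suc y) ∷ y ∷ K ++ R
      ≡⟨ solve 6 (λ P A Y₁ Y₀ T R → (P ⊕ (A ⊕ Y₁)) ⊕ (T ⊕ (Y₀ ⊕ ((Y₁ ⊕ Y₀) ⊕ R)))
                                  ⊜ (P ⊕ (A ⊕ (Y₁ ⊕ T))) ⊕ (Y₀ ⊕ (Y₁ ⊕ (Y₀ ⊕ R))))
               refl P A [ suc y ] [ y ] [ suc (suc y) ] R ⟩
    (P ++ A ++ suc y ∷ suc (suc y) ∷ []) ++ y ∷ suc y ∷ y ∷ R ∎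
    where open StarReasoning SymStep

-- The letters of F₂ (below y - 1) move right and those of A₁ above y + 2 move left, exposing
-- (y+1) y (y+1) y, or (y+1) y (y+2) (y+1) y ∼ (y+1) (y+2) y (y+1) y when y + 2 ∈ A₁.
fullyCommutative-noDoublePair : ∀ u F₁ F₂ A₁ A₂ w y →
  FullyCommutative (u ++ (F₁ ++ suc y ∷ y ∷ F₂) ++ (A₁ ++ suc y ∷ y ∷ A₂) ++ w) →
  All (λ p → suc p < y) F₂ → All (suc y <_) A₁ → Decreasing A₁ → ⊥
fullyCommutative-noDoublePair u F₁ F₂ A₁ A₂ w y fc F₂≪y y≪A₁ A₁↓ with topOf y A₁ A₁↓ y≪A₁
... | clear 2+y≪A₁ = fullyCommutative-no101 ((u ++ F₁) ++ A₁) (y ∷ F₂ ++ A₂ ++ w) y fc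
  (≡⇒heckeEq (regroup-factors y u F₁ F₂ A₁ A₂ w)
   ◅◅ lowLetters-commute y (u ++ F₁) F₂ A₁ (A₂ ++ w) F₂≪y y≪A₁
   ◅◅ highLetters-commute y (u ++ F₁) A₁ (F₂ ++ A₂ ++ w) 2+y≪A₁)
... | ending A₁′ refl 2+y≪A₁′ =
  fullyCommutative-no010 ((u ++ F₁) ++ A₁′ ++ suc y ∷ suc (suc y) ∷ []) (F₂ ++ A₂ ++ w) y fc
  (≡⇒heckeEq (regroup-factors y u F₁ F₂ (A₁′ ++ [ suc (suc y) ]) A₂ w)
   ◅◅ lowLetters-commute y (u ++ F₁) F₂ (A₁′ ++ [ suc (suc y) ]) (A₂ ++ w) F₂≪y y≪A₁
   ◅◅ highLetters-braid y (u ++ F₁) A₁′ (F₂ ++ A₂ ++ w) 2+y≪A₁′)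

decreasing-++⁻ˡ : ∀ xs {ys} → Decreasing (xs ++ ys) → Decreasing xs
decreasing-++⁻ˡ []       _                = []
decreasing-++⁻ˡ (x ∷ xs) (x>xs++ys ∷ xs↓) = ++⁻ˡ xs x>xs++ys ∷ decreasing-++⁻ˡ xs xs↓

fullyCommutative-noObstruction : ∀ u F A w y → FullyCommutative (u ++ F ++ A ++ w) →
  Decreasing F → Decreasing A → ¬ Obstruction F A y
fullyCommutative-noObstruction u F A w y fc F↓ A↓ ob =
  fullyCommutative-noDoublePair u SF.above SF.below SA.above SA.below w y
    (subst FullyCommutative (cong₂ (λ X Y → u ++ X ++ Y ++ w) SF.split SA.split) fc)
    (All.tabulate λ p∈F₂ → Obstruction.gap ob _ (below∈F p∈F₂) (All.lookup SF.below< p∈F₂))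
    SA.above>
    (decreasing-++⁻ˡ SA.above (subst Decreasing SA.split A↓))
  where
  module SF = PairSplit (pairSplit y F F↓ (Obstruction.1+y∈F ob) (Obstruction.y∈F ob))
  module SA = PairSplit (pairSplit y A A↓ (Obstruction.1+y∈A ob) (Obstruction.y∈A ob))
  below∈F : ∀ {p} → p ∈ SF.below → p ∈ F
  below∈F p∈F₂ = subst (_ ∈_) (sym SF.split) (∈-++⁺ʳ SF.above (there (there p∈F₂)))

-- Row insertion of a word

insertWord : Word → Tableau → Tableau
insertWord []      T = T
insertWord (c ∷ C) T = insertWord C (insertTab c T)

insertIntoRow : Word → Word → Word × Word
insertIntoRow []      R = R , []
insertIntoRow (c ∷ C) R with insertRow c R
... | stop R′   = insertIntoRow C R′
... | bump R′ y = proj₁ (insertIntoRow C R′) , y ∷ proj₂ (insertIntoRow C R′)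

insertWord-onRow : ∀ C R T →
  insertWord C (R ∷ T) ≡ proj₁ (insertIntoRow C R) ∷ insertWord (proj₂ (insertIntoRow C R)) T
insertWord-onRow []      R T = refl
insertWord-onRow (c ∷ C) R T with insertRow c R
... | stop R′   = insertWord-onRow C R′ T
... | bump R′ y = insertWord-onRow C R′ (insertTab y T)

allB-true : ∀ p R → All (λ y → p y ≡ true) R → allB p R ≡ true
allB-true p []      []         = refl
allB-true p (y ∷ R) (py ∷ pR) rewrite py = allB-true p R pR

allB-false : ∀ p R {a} → a ∈ R → p a ≡ false → allB p R ≡ false
allB-false p (y ∷ R) (here refl) pa rewrite pa = refl
allB-false p (y ∷ R) (there a∈R) pa with p y
... | true  = allB-false p R a∈R pa
... | false = refl

elem-true : ∀ x R → x ∈ R → elem x R ≡ true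
elem-true x (y ∷ R) (here refl) rewrite ≡ᵇ-refl x = refl
elem-true x (y ∷ R) (there x∈R) with x ≡ᵇ y
... | true  = refl
... | false = elem-true x R x∈R

elem-false : ∀ x R → All (x ≢_) R → elem x R ≡ false
elem-false x []      []           = refl
elem-false x (y ∷ R) (x≢y ∷ x∉R) rewrite ≡ᵇ-false x≢y = elem-false x R x∉R

bfilter-false-++ : ∀ p L R → All (λ y → p y ≡ false) L → bfilter p (L ++ R) ≡ bfilter p R
bfilter-false-++ p []      R []         = refl
bfilter-false-++ p (y ∷ L) R (py ∷ pL) rewrite py = bfilter-false-++ p L R pL

bfilter-true : ∀ p R → All (λ y → p y ≡ true) R → bfilter p R ≡ R
bfilter-true p []      []         = refl
bfilter-true p (y ∷ R) (py ∷ pR) rewrite py = cong (y ∷_) (bfilter-true p R pR)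

minimumM-satisfies : ∀ {P : ℕ → Set} w → All P w → ∀ {m} → minimumM w ≡ just m → P m
minimumM-satisfies (y ∷ w) (py ∷ pw) e with minimumM w in e′
minimumM-satisfies (y ∷ w) (py ∷ pw) refl | nothing = py
minimumM-satisfies (y ∷ w) (py ∷ pw) refl | just z with ⊓-sel y z
... | inj₁ y⊓z≡y rewrite y⊓z≡y = py
... | inj₂ y⊓z≡z rewrite y⊓z≡z = minimumM-satisfies w pw e′

minimumM-head : ∀ a D → All (a <_) D → minimumM (a ∷ D) ≡ just a
minimumM-head a D a<D with minimumM D in e
... | nothing = refl
... | just z  = cong just (m≤n⇒m⊓n≡m (<⇒≤ (minimumM-satisfies D a<D e)))

replaceOne-middle : ∀ a c L D → All (a ≢_) L → replaceOne a c (L ++ a ∷ D) ≡ L ++ c ∷ D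
replaceOne-middle a c []       D []           rewrite ≡ᵇ-refl a = refl
replaceOne-middle a c (z ∷ L) D (a≢z ∷ a∉L) rewrite ≡ᵇ-false a≢z =
  cong (z ∷_) (replaceOne-middle a c L D a∉L)

insertRow-append : ∀ c R → All (_< c) R → insertRow c R ≡ stop (R ++ [ c ])
insertRow-append c R R<c rewrite allB-true (λ y → y <ᵇ c) R (All.map <ᵇ-true R<c) = refl

insertRow-bumpLarger : ∀ {c a} L D → All (_< c) L → c < a → All (a <_) D →
  insertRow c (L ++ a ∷ D) ≡ bump (L ++ c ∷ D) a
insertRow-bumpLarger {c} {a} L D L<c c<a a<D
  rewrite allB-false (λ y → y <ᵇ c) (L ++ a ∷ D) (∈-++⁺ʳ L (here refl)) (<ᵇ-false (<⇒≤ c<a))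
        | elem-false c (L ++ a ∷ D)
            (++⁺ (All.map >⇒≢ L<c) (<⇒≢ c<a ∷ All.map (λ a<y → <⇒≢ (<-trans c<a a<y)) a<D))
        | bfilter-false-++ (c <ᵇ_) L (a ∷ D) (All.map (λ y<c → <ᵇ-false (<⇒≤ y<c)) L<c)
        | bfilter-true (c <ᵇ_) (a ∷ D) (<ᵇ-true c<a ∷ All.map (λ a<y → <ᵇ-true (<-trans c<a a<y)) a<D)
        | minimumM-head a D a<D
        | replaceOne-middle a c L D (All.map (λ y<c → >⇒≢ (<-trans y<c c<a)) L<c) = refl

downRun-stop : ∀ c R → (∀ k → c ≡ suc k → elem k R ≡ false) → downRun c R ≡ c
downRun-stop zero    R _        = refl
downRun-stop (suc k) R k∉R rewrite k∉R k refl = refl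

insertRow-bumpEqual : ∀ {c} L D → All (_< c) L → All (c <_) D → (∀ k → c ≡ suc k → ¬ k ∈ L) →
  insertRow c (L ++ c ∷ D) ≡ bump (L ++ c ∷ D) c
insertRow-bumpEqual {c} L D L<c c<D no-predecessor
  rewrite allB-false (λ y → y <ᵇ c) (L ++ c ∷ D) (∈-++⁺ʳ L (here refl)) (<ᵇ-false (≤-refl {c}))
        | elem-true c (L ++ c ∷ D) (∈-++⁺ʳ L (here refl))
        = cong (bump (L ++ c ∷ D)) (downRun-stop c (L ++ c ∷ D) predecessor-absent)
  where
  predecessor-absent : ∀ k → c ≡ suc k → elem k (L ++ c ∷ D) ≡ false
  predecessor-absent k refl = elem-false k (L ++ suc k ∷ D)
    (++⁺ (All.tabulate λ k′∈L k≡k′ → no-predecessor k refl (subst (_∈ L) (sym k≡k′) k′∈L))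
         (n≢1+n k ∷ All.map (λ 1+k<y → <⇒≢ (<-trans (n<1+n k) 1+k<y)) c<D))

data RowBumps : Word → Word → Word → Set where
  done    : ∀ {L} → RowBumps L [] []
  append  : ∀ {L c C} → All (_< c) L → RowBumps (L ++ [ c ]) C [] → RowBumps L (c ∷ C) []
  bumpOut : ∀ {L c C a D} → All (_< c) L → c ≤ a → All (a <_) D →
            (c ≡ a → ∀ k → c ≡ suc k → ¬ k ∈ L) →
            RowBumps (L ++ [ c ]) C D → RowBumps L (c ∷ C) (a ∷ D)

insertIntoRow-stop : ∀ c C R {R′} → insertRow c R ≡ stop R′ → insertIntoRow (c ∷ C) R ≡ insertIntoRow C R′
insertIntoRow-stop c C R e rewrite e = refl

insertIntoRow-bump : ∀ c C R {R′ y} → insertRow c R ≡ bump R′ y →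
  insertIntoRow (c ∷ C) R ≡ (proj₁ (insertIntoRow C R′) , y ∷ proj₂ (insertIntoRow C R′))
insertIntoRow-bump c C R e rewrite e = refl

insertIntoRow-bumps : ∀ {L C D} → RowBumps L C D → insertIntoRow C (L ++ D) ≡ (L ++ C , D)
insertIntoRow-bumps done = refl
insertIntoRow-bumps {L} {c ∷ C} (append L<c rest) = begin
  insertIntoRow (c ∷ C) (L ++ [])    ≡⟨ cong (insertIntoRow (c ∷ C)) (++-identityʳ L) ⟩
  insertIntoRow (c ∷ C) L            ≡⟨ insertIntoRow-stop c C L (insertRow-append c L L<c) ⟩
  insertIntoRow C (L ++ [ c ])       ≡⟨ cong (insertIntoRow C) (++-identityʳ (L ++ [ c ])) ⟨
  insertIntoRow C ((L ++ [ c ]) ++ []) ≡⟨ insertIntoRow-bumps rest ⟩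
  ((L ++ [ c ]) ++ C , [])           ≡⟨ cong (_, []) (++-assoc L [ c ] C) ⟩
  (L ++ c ∷ C , [])                  ∎
  where open ≡-Reasoning
insertIntoRow-bumps {L} {c ∷ C} {a ∷ D} (bumpOut L<c c≤a a<D no-predecessor rest) =
  trans (insertIntoRow-bump c C (L ++ a ∷ D) (step (m≤n⇒m<n∨m≡n c≤a)))
        (cong₂ _,_ (cong proj₁ inserted) (cong (a ∷_) (cong proj₂ inserted)))
  where
  step : c < a ⊎ c ≡ a → insertRow c (L ++ a ∷ D) ≡ bump (L ++ c ∷ D) a
  step (inj₁ c<a)  = insertRow-bumpLarger L D L<c c<a a<D
  step (inj₂ refl) = insertRow-bumpEqual L D L<c a<D (no-predecessor refl)
  inserted : insertIntoRow C (L ++ c ∷ D) ≡ (L ++ c ∷ C , D)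
  inserted = trans (cong (insertIntoRow C) (sym (++-assoc L [ c ] D)))
                   (trans (insertIntoRow-bumps rest) (cong (_, D) (++-assoc L [ c ] C)))

data StacksOnto : Word → Tableau → Set where
  onEmpty : ∀ {c C} → RowBumps [ c ] C [] → StacksOnto (c ∷ C) []
  onRow   : ∀ {C D T} → RowBumps [] C D → StacksOnto D T → StacksOnto C (D ∷ T)

insertWord-stacks : ∀ {C T} → StacksOnto C T → insertWord C T ≡ C ∷ T
insertWord-stacks {c ∷ C} (onEmpty bumps) =
  trans (insertWord-onRow C [ c ] [])
        (cong₂ (λ R D → R ∷ insertWord D []) (cong proj₁ (insertIntoRow-bumps bumps))
                                             (cong proj₂ (insertIntoRow-bumps bumps)))
insertWord-stacks {C} {D ∷ T} (onRow bumps stacks) =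
  trans (insertWord-onRow C D T)
        (cong₂ _∷_ (cong proj₁ (insertIntoRow-bumps bumps))
                   (trans (cong (λ D′ → insertWord D′ T) (cong proj₂ (insertIntoRow-bumps bumps)))
                          (insertWord-stacks stacks)))

countAtMost : ℕ → Word → ℕ
countAtMost t []      = 0
countAtMost t (x ∷ w) = (if x ≤ᵇ t then 1 else 0) + countAtMost t w

countAtMost-++ : ∀ t u v → countAtMost t (u ++ v) ≡ countAtMost t u + countAtMost t v
countAtMost-++ t []      v = refl
countAtMost-++ t (x ∷ u) v rewrite countAtMost-++ t u v = sym (+-assoc (if x ≤ᵇ t then 1 else 0) _ _)

countAtMost-reverse : ∀ t w → countAtMost t (reverse w) ≡ countAtMost t w
countAtMost-reverse t []      = refl
countAtMost-reverse t (x ∷ w)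
  rewrite unfold-reverse x w | countAtMost-++ t (reverse w) [ x ] | countAtMost-reverse t w
  = trans (cong (countAtMost t w +_) (+-identityʳ _)) (+-comm (countAtMost t w) _)

countAtMost-above : ∀ t w → All (t <_) w → countAtMost t w ≡ 0
countAtMost-above t []      []            = refl
countAtMost-above t (x ∷ w) (t<x ∷ t<w) rewrite ≤ᵇ-false t<x = countAtMost-above t w t<w

countAtMost-head : ∀ a w → 1 ≤ countAtMost a (a ∷ w)
countAtMost-head a w rewrite ≤ᵇ-true (≤-refl {a}) = s≤s z≤n

countAtMost-removeOne : ∀ t a A → countAtMost t A ≤ suc (countAtMost t (removeOne a A))
countAtMost-removeOne t a []      = z≤n
countAtMost-removeOne t a (y ∷ A) with a ≡ᵇ y
... | true  = +-monoˡ-≤ (countAtMost t A) (bit≤1 (y ≤ᵇ t))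
  where
  bit≤1 : ∀ b → (if b then 1 else 0) ≤ 1
  bit≤1 true  = ≤-refl
  bit≤1 false = z≤n
... | false =
  ≤-trans (+-monoʳ-≤ (if y ≤ᵇ t then 1 else 0) (countAtMost-removeOne t a A)) (≤-reflexive (+-suc _ _))

countAtMost-removeOne-above : ∀ t a A → t < a → countAtMost t (removeOne a A) ≡ countAtMost t A
countAtMost-removeOne-above t a []      t<a = refl
countAtMost-removeOne-above t a (y ∷ A) t<a with a ≟ y
... | yes refl rewrite ≡ᵇ-refl a | ≤ᵇ-false t<a = refl
... | no a≢y rewrite ≡ᵇ-false a≢y = cong ((if y ≤ᵇ t then 1 else 0) +_) (countAtMost-removeOne-above t a A t<a)

length-removeOne : ∀ a A → length A ≤ suc (length (removeOne a A))
length-removeOne a []      = z≤n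
length-removeOne a (y ∷ A) with a ≡ᵇ y
... | true  = ≤-refl
... | false = s≤s (length-removeOne a A)

bfilter-satisfies : ∀ p w → All (λ y → p y ≡ true) (bfilter p w)
bfilter-satisfies p []      = []
bfilter-satisfies p (y ∷ w) with p y in e
... | true  = e ∷ bfilter-satisfies p w
... | false = bfilter-satisfies p w

paired⇒countAtMost≤ : ∀ B A → unpaired B A ≡ [] → ∀ t → countAtMost t A ≤ countAtMost t B
paired⇒countAtMost≤ []      A e t rewrite e = ≤-refl
paired⇒countAtMost≤ (b ∷ B) A e t with minimumM (bfilter (b ≤ᵇ_) A) in em
... | nothing = ≤-trans (paired⇒countAtMost≤ B A e t) (m≤n+m (countAtMost t B) _)
... | just a with b ≤? t
...   | yes b≤t rewrite ≤ᵇ-true b≤t =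
  ≤-trans (countAtMost-removeOne t a A) (s≤s (paired⇒countAtMost≤ B (removeOne a A) e t))
...   | no b≰t rewrite ≤ᵇ-false (≰⇒> b≰t) =
  subst (_≤ countAtMost t B) (countAtMost-removeOne-above t a A (<-≤-trans (≰⇒> b≰t) b≤a))
        (paired⇒countAtMost≤ B (removeOne a A) e t)
  where
  b≤a : b ≤ a
  b≤a = ≤ᵇ⇒≤ b a
    (subst T (sym (minimumM-satisfies (bfilter (b ≤ᵇ_) A) (bfilter-satisfies (b ≤ᵇ_) A) em)) _)

length≤length+unpaired : ∀ B A → length A ≤ length B + length (unpaired B A)
length≤length+unpaired []      A = ≤-refl
length≤length+unpaired (b ∷ B) A with minimumM (bfilter (b ≤ᵇ_) A)
... | nothing = ≤-trans (length≤length+unpaired B A) (n≤1+n _)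
... | just a  = ≤-trans (length-removeOne a A) (s≤s (length≤length+unpaired B (removeOne a A)))

paired⇒length≤ : ∀ B A → unpaired B A ≡ [] → length A ≤ length B
paired⇒length≤ B A paired = subst (length A ≤_)
  (trans (cong (λ u → length B + length u) paired) (+-identityʳ _)) (length≤length+unpaired B A)

-- Inserting a factor into the row of the previous one

Increasing : Word → Set
Increasing = AllPairs _<_

all-reverse : ∀ {P : ℕ → Set} {w} → All P w → All P (reverse w)
all-reverse Pw = All.tabulate λ x∈rw → All.lookup Pw (Any.reverse⁻ x∈rw)

decreasing-reverse : ∀ w → Decreasing w → Increasing (reverse w)
decreasing-reverse []      []           = []
decreasing-reverse (x ∷ w) (x>w ∷ w↓) rewrite unfold-reverse x w =
  AllPairs-++⁺ (decreasing-reverse w w↓) ([] ∷ [])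
    (All.map (λ y<x → y<x ∷ []) (all-reverse x>w))

obstruction-mono : ∀ {F A F′ A′ w} → F ⊆ F′ → A ⊆ A′ → (∀ {p} → p ∈ F′ → p < w → p ∈ F) →
                   Obstruction F A w → Obstruction F′ A′ w
obstruction-mono F⊆F′ A⊆A′ small∈F ob = record
  { 1+y∈F = F⊆F′ 1+y∈F ; y∈F = F⊆F′ y∈F ; 1+y∈A = A⊆A′ 1+y∈A ; y∈A = A⊆A′ y∈A
  ; gap = λ p p∈F′ p<w → gap p (small∈F p∈F′ p<w) p<w }
  where open Obstruction ob

-- Follow the common run y, y - 1, … at the heads of P and Q down to its end.
lowestObstruction : ∀ y P Q → Decreasing (y ∷ P) → Decreasing (y ∷ Q) → Pointwise _≤_ P Q →
  Σ ℕ λ w → w ≤ y × Obstruction (suc y ∷ y ∷ P) (suc y ∷ y ∷ Q) w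
lowestObstruction y [] [] _ _ [] = y , ≤-refl , record
  { 1+y∈F = here refl ; y∈F = there (here refl) ; 1+y∈A = here refl ; y∈A = there (here refl)
  ; gap = λ { p (here refl) p<y → ⊥-elim (<-asym p<y (n<1+n y))
            ; p (there (here refl)) p<y → ⊥-elim (<-irrefl refl p<y) } }
lowestObstruction y (p₁ ∷ P) (q₁ ∷ Q) ((p₁<y ∷ _) ∷ P↓) ((q₁<y ∷ _) ∷ Q↓) (p₁≤q₁ ∷ P≤Q)
  with m≤n⇒m<n∨m≡n p₁<y
... | inj₁ 1+p₁<y = y , ≤-refl , record
  { 1+y∈F = here refl ; y∈F = there (here refl) ; 1+y∈A = here refl ; y∈A = there (here refl)
  ; gap = gap }
  where
  gap : ∀ p → p ∈ suc y ∷ y ∷ p₁ ∷ P → p < y → suc p < y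
  gap p (here refl)                 p<y = ⊥-elim (<-asym p<y (n<1+n y))
  gap p (there (here refl))         p<y = ⊥-elim (<-irrefl refl p<y)
  gap p (there (there (here refl))) p<y = 1+p₁<y
  gap p (there (there (there p∈P))) p<y = <-trans (s≤s (All.lookup (AllPairs.head P↓) p∈P)) 1+p₁<y
... | inj₂ refl with ≤-antisym (≤-pred q₁<y) p₁≤q₁
...   | refl with lowestObstruction p₁ P Q P↓ Q↓ P≤Q
...     | w , w≤p₁ , ob = w , ≤-trans w≤p₁ (n≤1+n p₁) , obstruction-mono there there small∈ ob
  where
  small∈ : ∀ {p} → p ∈ suc (suc p₁) ∷ suc p₁ ∷ p₁ ∷ P → p < w → p ∈ suc p₁ ∷ p₁ ∷ P
  small∈ (here refl) p<w = ⊥-elim (<-asym p<w (<-trans (s≤s w≤p₁) (n<1+n (suc p₁))))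
  small∈ (there p∈)  _   = p∈

-- The state of inserting hⁱ⁺¹ = reverse C ++ P into the row hⁱ = reverse D ++ Q, once the
-- letters of P have been inserted and those of Q bumped.
record PairedInsertion (P Q C D : Word) : Set where
  field
    C↑  : Increasing C
    D↑  : Increasing D
    P↓  : Decreasing P
    Q↓  : Decreasing Q
    P<C : All (λ p → All (p <_) C) P
    Q<D : All (λ q → All (q <_) D) Q
    P≤Q : Pointwise _≤_ P Q
    count≤ : ∀ t → countAtMost t D ≤ countAtMost t C
    unobstructed : ∀ y → ¬ Obstruction (reverse C ++ P) (reverse D ++ Q) y

rowBumps-append : ∀ P C → Increasing C → All (λ p → All (p <_) C) P → RowBumps (reverse P) C []
rowBumps-append P []      _            _    = done
rowBumps-append P (c ∷ C) (c<C ∷ C↑) P<cC =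
  append (all-reverse (All.map All.head P<cC))
    (subst (λ X → RowBumps X C []) (unfold-reverse c P)
      (rowBumps-append (c ∷ P) C C↑ (c<C ∷ All.map All.tail P<cC)))

pointwise-head : ∀ {k P Q} → Pointwise _≤_ (k ∷ P) Q → All (_< suc k) Q →
                 Σ Word λ Q′ → Q ≡ k ∷ Q′ × Pointwise _≤_ P Q′
pointwise-head (k≤q ∷ P≤Q′) (q<k+1 ∷ _) = _ , cong (_∷ _) (≤-antisym (≤-pred q<k+1) k≤q) , P≤Q′

reverse-∷-++ : ∀ (C : Word) c P → reverse (c ∷ C) ++ P ≡ reverse C ++ c ∷ P
reverse-∷-++ C c P rewrite unfold-reverse c C = ++-assoc (reverse C) [ c ] P

noPredecessor : ∀ {k P Q C D} → Decreasing P → Decreasing Q →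
  All (_< suc k) P → All (_< suc k) Q → Pointwise _≤_ P Q → All (suc k ≤_) C →
  (∀ y → ¬ Obstruction (reverse (suc k ∷ C) ++ P) (reverse (suc k ∷ D) ++ Q) y) → ¬ k ∈ P
noPredecessor {k} {P} {Q} {C} {D} P↓ Q↓ P<k+1 Q<k+1 P≤Q k+1≤C unobstructed k∈P
  with decreasing-head P↓ P<k+1 k∈P
... | P′ , refl with pointwise-head P≤Q Q<k+1
...   | Q′ , refl , P′≤Q′ with lowestObstruction k P′ Q′ P↓ Q↓ P′≤Q′
...     | w , w≤k , ob = unobstructed w (obstruction-mono (lift C) (lift D) small∈ ob)
  where
  lift : ∀ E {R} → suc k ∷ R ⊆ reverse (suc k ∷ E) ++ R
  lift E (here refl) = ∈-++⁺ˡ (Any.reverse⁺ {xs = suc k ∷ E} (here refl))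
  lift E (there x∈R) = ∈-++⁺ʳ (reverse (suc k ∷ E)) x∈R
  small∈ : ∀ {p} → p ∈ reverse (suc k ∷ C) ++ k ∷ P′ → p < w → p ∈ suc k ∷ k ∷ P′
  small∈ p∈ p<w with ∈-++⁻ (reverse (suc k ∷ C)) p∈
  ... | inj₂ p∈P = there p∈P
  ... | inj₁ p∈C′ with Any.reverse⁻ {xs = suc k ∷ C} p∈C′
  ...   | here refl  = ⊥-elim (<-asym p<w (s≤s w≤k))
  ...   | there p∈C = ⊥-elim (<⇒≱ p<w (≤-trans (n≤1+n _) (≤-trans (s≤s w≤k) (All.lookup k+1≤C p∈C))))

pairedInsertion⇒rowBumps : ∀ P Q C D → PairedInsertion P Q C D → RowBumps (reverse P) C D
pairedInsertion⇒rowBumps P Q []      []      _ = done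
pairedInsertion⇒rowBumps P Q []      (a ∷ D) s =
  ⊥-elim (1+n≰n (≤-trans (countAtMost-head a D) (PairedInsertion.count≤ s a)))
pairedInsertion⇒rowBumps P Q (c ∷ C) []      s =
  rowBumps-append P (c ∷ C) (PairedInsertion.C↑ s) (PairedInsertion.P<C s)
pairedInsertion⇒rowBumps P Q (c ∷ C) (a ∷ D) s =
  bumpOut (all-reverse (All.map All.head P<C)) c≤a (AllPairs.head D↑) no-predecessor
    (subst (λ X → RowBumps X C D) (unfold-reverse c P) (pairedInsertion⇒rowBumps (c ∷ P) (a ∷ Q) C D next))
  where
  open PairedInsertion s
  c≤a : c ≤ a
  c≤a with c ≤? a
  ... | yes c≤a = c≤a
  ... | no c≰a = ⊥-elim (1+n≰n (≤-trans (countAtMost-head a D)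
                   (≤-trans (count≤ a) (≤-reflexive (countAtMost-above a (c ∷ C) a<cC)))))
    where
    a<cC : All (a <_) (c ∷ C)
    a<cC = ≰⇒> c≰a ∷ All.map (<-trans (≰⇒> c≰a)) (AllPairs.head C↑)
  no-predecessor : c ≡ a → ∀ k → c ≡ suc k → ¬ k ∈ reverse P
  no-predecessor refl k refl k∈P = noPredecessor {C = C} {D = D} P↓ Q↓ (All.map All.head P<C)
    (All.map All.head Q<D) P≤Q (All.map <⇒≤ (AllPairs.head C↑)) unobstructed (Any.reverse⁻ k∈P)
  count≤′ : ∀ t → countAtMost t D ≤ countAtMost t C
  count≤′ t with a ≤? t
  ... | yes a≤t = ≤-pred (subst₂ _≤_ (counted a D a≤t) (counted c C (≤-trans c≤a a≤t)) (count≤ t))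
    where
    counted : ∀ x E → x ≤ t → countAtMost t (x ∷ E) ≡ suc (countAtMost t E)
    counted x E x≤t rewrite ≤ᵇ-true x≤t = refl
  ... | no a≰t =
    ≤-trans (≤-reflexive (countAtMost-above t D (All.map (<-trans (≰⇒> a≰t)) (AllPairs.head D↑)))) z≤n
  next : PairedInsertion (c ∷ P) (a ∷ Q) C D
  next = record
    { C↑ = AllPairs.tail C↑ ; D↑ = AllPairs.tail D↑
    ; P↓ = All.map All.head P<C ∷ P↓ ; Q↓ = All.map All.head Q<D ∷ Q↓
    ; P<C = AllPairs.head C↑ ∷ All.map All.tail P<C ; Q<D = AllPairs.head D↑ ∷ All.map All.tail Q<D
    ; P≤Q = c≤a ∷ P≤Q ; count≤ = count≤′
    ; unobstructed = λ y → unobstructed y ∘ subst₂ (λ F A → Obstruction F A y)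
                             (sym (reverse-∷-++ C c P)) (sym (reverse-∷-++ D a Q)) }

rowBumps-pairedFactors : ∀ F A → Decreasing F → Decreasing A → unpaired F A ≡ [] →
  (∀ y → ¬ Obstruction F A y) → RowBumps [] (reverse F) (reverse A)
rowBumps-pairedFactors F A F↓ A↓ paired unobstructed =
  pairedInsertion⇒rowBumps [] [] (reverse F) (reverse A) initial
  where
  reverse² : ∀ L → reverse (reverse L) ++ [] ≡ L
  reverse² L = trans (++-identityʳ _) (reverse-involutive L)
  initial : PairedInsertion [] [] (reverse F) (reverse A)
  initial = record
    { C↑ = decreasing-reverse F F↓ ; D↑ = decreasing-reverse A A↓
    ; P↓ = [] ; Q↓ = [] ; P<C = [] ; Q<D = [] ; P≤Q = []
    ; count≤ = λ t → subst₂ _≤_ (sym (countAtMost-reverse t A)) (sym (countAtMost-reverse t F))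
                                (paired⇒countAtMost≤ F A paired t)
    ; unobstructed = λ y → unobstructed y ∘ subst₂ (λ F A → Obstruction F A y) (reverse² F) (reverse² A) }

stacksOnto-empty : ∀ C → Increasing C → 0 < length C → StacksOnto C []
stacksOnto-empty (c ∷ C) (c<C ∷ C↑) _ = onEmpty (rowBumps-append [ c ] C C↑ (c<C ∷ []))

just≢nothing : ∀ {A : Set} {a : A} → just a ≢ nothing
just≢nothing ()

maximumM≡nothing : ∀ w → maximumM w ≡ nothing → w ≡ []
maximumM≡nothing []      _ = refl
maximumM≡nothing (y ∷ w) e with maximumM w
... | nothing = ⊥-elim (just≢nothing e)
... | just _  = ⊥-elim (just≢nothing e)

fStar≡nothing⇒paired : ∀ {m} i (h : Fact m) → fStar i h ≡ nothing → unpaired (fac h (suc i)) (fac h i) ≡ []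
fStar≡nothing⇒paired i h e with maximumM (unpaired (fac h (suc i)) (fac h i)) in e′
... | nothing = maximumM≡nothing _ e′
... | just x with elem (suc x) (fac h i) ∧ elem (suc x) (fac h (suc i))
...   | true  = ⊥-elim (just≢nothing e)
...   | false = ⊥-elim (just≢nothing e)

Paired : ∀ {m} → Fact m → Set
Paired {m} h = ∀ i → 1 ≤ i → i < m → unpaired (fac h (suc i)) (fac h i) ≡ []

paired-tail : ∀ {m} x (xs : Fact m) → Paired (x ∷ᵥ xs) → Paired xs
paired-tail x xs paired (suc i) _ i<m = paired (suc (suc i)) (s≤s z≤n) (s≤s i<m)

word-∷ : ∀ {m} x (xs : Fact m) → word (x ∷ᵥ xs) ≡ word xs ++ x
word-∷ x xs = begin
  concat (reverse (x ∷ toList xs))        ≡⟨ cong concat (unfold-reverse x (toList xs)) ⟩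
  concat (reverse (toList xs) ++ [ x ])   ≡⟨ concat-++ (reverse (toList xs)) [ x ] ⟨
  word xs ++ x ++ []                      ≡⟨ cong (word xs ++_) (++-identityʳ x) ⟩
  word xs ++ x                            ∎
  where open ≡-Reasoning

RowChain : ∀ {m} → Fact m → Set
RowChain []ᵥ               = ⊤
RowChain (x ∷ᵥ []ᵥ)        = ⊤
RowChain (x ∷ᵥ y ∷ᵥ xs)    = RowBumps [] (reverse y) (reverse x) × RowChain (y ∷ᵥ xs)

fullyCommutative-rowChain : ∀ {m} (h : Fact m) w → All Decreasing (toList h) →
  FullyCommutative (word h ++ w) → Paired h → RowChain h
fullyCommutative-rowChain []ᵥ            w _               _  _      = tt
fullyCommutative-rowChain (x ∷ᵥ []ᵥ)     w _               _  _      = tt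
fullyCommutative-rowChain (x ∷ᵥ y ∷ᵥ xs) w (x↓ ∷ y↓ ∷ xs↓) fc paired =
  rowBumps-pairedFactors y x y↓ x↓ (paired 1 ≤-refl (s≤s (s≤s z≤n)))
    (λ z → fullyCommutative-noObstruction (word xs) y x w z (subst FullyCommutative split fc) y↓ x↓) ,
  fullyCommutative-rowChain (y ∷ᵥ xs) (x ++ w) (y↓ ∷ xs↓)
    (subst FullyCommutative (word-∷-++ (y ∷ᵥ xs)) fc) (paired-tail x (y ∷ᵥ xs) paired)
  where
  word-∷-++ : ∀ {n} (ys : Fact n) → word (x ∷ᵥ ys) ++ w ≡ word ys ++ x ++ w
  word-∷-++ ys = trans (cong (_++ w) (word-∷ x ys)) (++-assoc (word ys) x w)
  split : word (x ∷ᵥ y ∷ᵥ xs) ++ w ≡ word xs ++ y ++ x ++ w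
  split = trans (word-∷-++ (y ∷ᵥ xs))
                (trans (cong (_++ x ++ w) (word-∷ y xs)) (++-assoc (word xs) y (x ++ w)))

insertWord-++ : ∀ X Y T → insertWord (X ++ Y) T ≡ insertWord Y (insertWord X T)
insertWord-++ []      Y T = refl
insertWord-++ (c ∷ X) Y T = insertWord-++ X Y (insertTab c T)

foldr-insertTab : ∀ x T → foldr insertTab T x ≡ insertWord (reverse x) T
foldr-insertTab []      T = refl
foldr-insertTab (c ∷ x) T rewrite unfold-reverse c x | insertWord-++ (reverse x) [ c ] T =
  cong (insertTab c) (foldr-insertTab x T)

foldr-insertTab-word-∷ : ∀ {m} x (xs : Fact m) T →
  foldr insertTab T (word (x ∷ᵥ xs)) ≡ foldr insertTab (insertWord (reverse x) T) (word xs)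
foldr-insertTab-word-∷ x xs T rewrite word-∷ x xs | foldr-++ insertTab T (word xs) x =
  cong (λ S → foldr insertTab S (word xs)) (foldr-insertTab x T)

rows : ∀ {m} → Fact m → Tableau
rows []ᵥ       = []
rows (x ∷ᵥ xs) = rows xs ++ [ reverse x ]

insertFactors-rows : ∀ {m} (xs : Fact m) G T → RowChain (G ∷ᵥ xs) → StacksOnto (reverse G) T →
  foldr insertTab (reverse G ∷ T) (word xs) ≡ rows xs ++ reverse G ∷ T
insertFactors-rows []ᵥ       G T _ _ = refl
insertFactors-rows (x ∷ᵥ xs) G T (x-bumps-G , chain) stacks = begin
  foldr insertTab (reverse G ∷ T) (word (x ∷ᵥ xs))
    ≡⟨ foldr-insertTab-word-∷ x xs (reverse G ∷ T) ⟩
  foldr insertTab (insertWord (reverse x) (reverse G ∷ T)) (word xs)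
    ≡⟨ cong (λ S → foldr insertTab S (word xs)) (insertWord-stacks stacks′) ⟩
  foldr insertTab (reverse x ∷ reverse G ∷ T) (word xs)
    ≡⟨ insertFactors-rows xs x (reverse G ∷ T) chain stacks′ ⟩
  rows xs ++ reverse x ∷ reverse G ∷ T
    ≡⟨ ++-assoc (rows xs) [ reverse x ] _ ⟨
  rows (x ∷ᵥ xs) ++ reverse G ∷ T   ∎
  where
  open ≡-Reasoning
  stacks′ : StacksOnto (reverse x) (reverse G ∷ T)
  stacks′ = onRow x-bumps-G stacks

map-upTo-cong : ∀ n {f g : ℕ → Word} → (∀ k → k < n → f k ≡ g k) → map f (upTo n) ≡ map g (upTo n)
map-upTo-cong n f≡g = map-cong-local (All.map (λ {k} → f≡g k) (all-upTo n))

fac-∷ : ∀ {m} x (xs : Fact m) k → k < m → fac (x ∷ᵥ xs) (suc m ∸ k) ≡ fac xs (m ∸ k)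
fac-∷ {m} x xs k k<m rewrite +-∸-assoc 1 (<⇒≤ k<m) = shift (m ∸ k) (m<n⇒0<n∸m k<m)
  where
  shift : ∀ j → 0 < j → fac (x ∷ᵥ xs) (suc j) ≡ fac xs j
  shift (suc j) _ = refl

rowsFrom-1 : ∀ {m} (h : Fact m) → rowsFrom h 1 ≡ rows h
rowsFrom-1 []ᵥ = refl
rowsFrom-1 {suc m} (x ∷ᵥ xs) = begin
  map f (upTo (suc m))           ≡⟨ cong (map f) (applyUpTo-∷ʳ (λ k → k) m) ⟨
  map f (upTo m ++ [ m ])        ≡⟨ map-++ f (upTo m) [ m ] ⟩
  map f (upTo m) ++ [ f m ]      ≡⟨ cong₂ (λ R r → R ++ [ r ])
                                          (map-upTo-cong m (λ k k<m → cong reverse (fac-∷ x xs k k<m)))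
                                          (cong (λ j → reverse (fac (x ∷ᵥ xs) j)) (m+n∸n≡m 1 m)) ⟩
  rowsFrom xs 1 ++ [ reverse x ] ≡⟨ cong (_++ [ reverse x ]) (rowsFrom-1 xs) ⟩
  rows xs ++ [ reverse x ]       ∎
  where
  open ≡-Reasoning
  f : ℕ → Word
  f k = reverse (fac (x ∷ᵥ xs) (suc m ∸ k))

rowsFrom-∷ : ∀ {m} x (xs : Fact m) r → rowsFrom (x ∷ᵥ xs) (suc (suc r)) ≡ rowsFrom xs (suc r)
rowsFrom-∷ {m} x xs r =
  map-upTo-cong (m ∸ r) (λ k k<m∸r → cong reverse (fac-∷ x xs k (<-≤-trans k<m∸r (m∸n≤m m r))))

rowChain-tail : ∀ {m} x (xs : Fact m) → RowChain (x ∷ᵥ xs) → RowChain xs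
rowChain-tail x []ᵥ       _           = tt
rowChain-tail x (y ∷ᵥ xs) (_ , chain) = chain

record StackedFrom {m} (h : Fact m) (r : ℕ) : Set where
  constructor stackedFrom
  field
    1≤r    : 1 ≤ r
    r≤1+m  : r ≤ suc m
    empty  : ∀ i → 1 ≤ i → i < r → wt h i ≡ 0
    Pstar≡ : Pstar h ≡ rowsFrom h r

Pstar-stacked : ∀ {m} (h : Fact m) → All Decreasing (toList h) → RowChain h → Σ ℕ (StackedFrom h)
Pstar-stacked []ᵥ _ _ = 1 , stackedFrom ≤-refl ≤-refl (λ i 1≤i i<1 → ⊥-elim (<⇒≱ i<1 1≤i)) refl
Pstar-stacked ([] ∷ᵥ xs) (_ ∷ xs↓) chain with Pstar-stacked xs xs↓ (rowChain-tail [] xs chain)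
... | suc r , stackedFrom _ r≤m+1 empty P≡rows =
  suc (suc r) , stackedFrom (s≤s z≤n) (s≤s r≤m+1) empty′
    (trans (foldr-insertTab-word-∷ [] xs []) (trans P≡rows (sym (rowsFrom-∷ [] xs r))))
  where
  empty′ : ∀ i → 1 ≤ i → i < suc (suc r) → wt ([] ∷ᵥ xs) i ≡ 0
  empty′ (suc zero)    _ _           = refl
  empty′ (suc (suc i)) _ (s≤s i<r+1) = empty (suc i) (s≤s z≤n) i<r+1
Pstar-stacked (x@(_ ∷ _) ∷ᵥ xs) (x↓ ∷ _) chain =
  1 , stackedFrom ≤-refl (s≤s z≤n) (λ i 1≤i i<1 → ⊥-elim (<⇒≱ i<1 1≤i)) (begin
    Pstar (x ∷ᵥ xs)                                       ≡⟨ foldr-insertTab-word-∷ x xs [] ⟩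
    foldr insertTab (insertWord (reverse x) []) (word xs) ≡⟨ cong (λ S → foldr insertTab S (word xs))
                                                                  (insertWord-stacks bottom) ⟩
    foldr insertTab (reverse x ∷ []) (word xs)            ≡⟨ insertFactors-rows xs x [] chain bottom ⟩
    rows (x ∷ᵥ xs)                                        ≡⟨ rowsFrom-1 (x ∷ᵥ xs) ⟨
    rowsFrom (x ∷ᵥ xs) 1                                  ∎)
  where
  open ≡-Reasoning
  bottom : StacksOnto (reverse x) []
  bottom = stacksOnto-empty (reverse x) (decreasing-reverse x x↓)
             (subst (0 <_) (sym (length-reverse x)) (s≤s z≤n))

proposition4p19 : (m : ℕ) (h : Fact m) → InH m h → LowestWeight m h →
    Σ ℕ (λ r → 1 ≤ r × r ≤ suc m
    × (∀ i → 1 ≤ i → i < r → wt h i ≡ 0)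
    × (∀ i → 1 ≤ i → i < m → wt h i ≤ wt h (suc i))
    × Pstar h ≡ rowsFrom h r)
proposition4p19 m h (linked , _ , fc) lowest = r , 1≤r , r≤1+m , empty , weakly-increasing , Pstar≡
  where
  decreasing : All Decreasing (toList h)
  decreasing = All.map (Linked⇒AllPairs (λ y<x z<y → <-trans z<y y<x)) linked
  paired : Paired h
  paired i 1≤i i<m = fStar≡nothing⇒paired i h (lowest i 1≤i i<m)
  chain : RowChain h
  chain = fullyCommutative-rowChain h [] decreasing
            (subst FullyCommutative (sym (++-identityʳ (word h))) fc) paired
  open Σ (Pstar-stacked h decreasing chain) renaming (proj₁ to r; proj₂ to stacked)
  open StackedFrom stacked
  weakly-increasing : ∀ i → 1 ≤ i → i < m → wt h i ≤ wt h (suc i)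
  weakly-increasing i 1≤i i<m = paired⇒length≤ (fac h (suc i)) (fac h i) (paired i 1≤i i<m)
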